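{- For $n\ge1$ let $C_n(x,y,z)=\sum_{\sigma\in Q_n}x^{\mathrm{des}(\sigma)}y^{\mathrm{asc}(\sigma)}z^{\mathrm{plat}(\sigma)}$. Then $C_n(x,y,z)$ can be written as $$C_n(x,y,z)=\sum_{i+2j+3k=2n+1}\gamma_{n,i,j,k}\,(x+y+z)^i(xy+xz+yz)^j(xyz)^k,$$ where, for nonnegative integers $i,j,k$ with $i+2j+3k=2n+1$, the coefficient $\gamma_{n,i,j,k}$ equals the number of 0-1-2-3 increasing plane trees on $[n]$ with $k$ leaves, $j$ vertices of degree one and $i$ vertices of degree two. In particular $C_n(x,y,z)$ is $e$-positive.
   Context: For $n\ge1$, a Stirling permutation of the multiset $\{1,1,2,2,\dots,n,n\}$ is a word $\sigma=\sigma_1\cdots\sigma_{2n}$ using each $j\in[n]$ exactly twice such that for every $j$ all entries between the two occurrences of $j$ are greater than $j$; $Q_n$ is the set of such permutations. Set $\sigma_0=\sigma_{2n+1}=0$. An index $1\le i\le 2n$ is a descent if $\sigma_i>\sigma_{i+1}$, an ascent if $\sigma_{i-1}<\sigma_i$, and a plateau if $\sigma_i=\sigma_{i+1}$; $\mathrm{des},\mathrm{asc},\mathrm{plat}$ count these. An increasing plane tree on $[n]$ is a rooted plane (children ordered) tree with vertex set $[n]$ whose labels increase along every path from the root; it is a 0-1-2-3 increasing plane tree if every vertex has at most three children. The degree of a vertex is its number of children; a leaf has degree zero. A symmetric polynomial is $e$-positive if it is a polynomial with nonnegative coefficients in the elementary symmetric functions. -}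

module Defs where

open import Level using (Level)
open import Data.Nat using (ℕ; zero; suc; _+_; _*_; _≡ᵇ_; _<ᵇ_)
open import Data.Bool using (Bool; true; false; _∧_; not; if_then_else_)
open import Data.List using (List; []; _∷_; [_]; _++_; map; concatMap; length; upTo; foldr)
open import Data.Product using (_×_; _,_)
open import Algebra.Bundles using (CommutativeSemiring)
import Algebra.Definitions.RawSemiring as RSDefs

range : ℕ → List ℕ
range k = map suc (upTo k)

range0 : ℕ → List ℕ
range0 k = upTo (suc k)

filterᵇ : {A : Set} → (A → Bool) → List A → List A
filterᵇ p [] = []
filterᵇ p (a ∷ as) = if p a then a ∷ filterᵇ p as else filterᵇ p as

countᵇ : {A : Set} → (A → Bool) → List A → ℕ
countᵇ p as = length (filterᵇ p as)

allᵇ : {A : Set} → (A → Bool) → List A → Bool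
allᵇ p [] = true
allᵇ p (a ∷ as) = p a ∧ allᵇ p as

occ : ℕ → List ℕ → ℕ
occ j w = countᵇ (λ a → a ≡ᵇ j) w

dropUntil : ℕ → List ℕ → List ℕ
dropUntil j [] = []
dropUntil j (a ∷ w) = if a ≡ᵇ j then w else dropUntil j w

takeUntil : ℕ → List ℕ → List ℕ
takeUntil j [] = []
takeUntil j (a ∷ w) = if a ≡ᵇ j then [] else a ∷ takeUntil j w

between : ℕ → List ℕ → List ℕ
between j w = takeUntil j (dropUntil j w)

pairs : List ℕ → List (ℕ × ℕ)
pairs [] = []
pairs (a ∷ []) = []
pairs (a ∷ b ∷ w) = (a , b) ∷ pairs (b ∷ w)

words : ℕ → ℕ → List (List ℕ)
words zero k = [ [] ]
words (suc m) k = concatMap (λ a → map (a ∷_) (words m k)) (range k)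

isStirling : ℕ → List ℕ → Bool
isStirling n w =
  (length w ≡ᵇ 2 * n) ∧
  allᵇ (λ a → (0 <ᵇ a) ∧ (a <ᵇ suc n)) w ∧
  allᵇ (λ j → (occ j w ≡ᵇ 2) ∧ allᵇ (λ a → j <ᵇ a) (between j w)) (range n)

Q : ℕ → List (List ℕ)
Q n = filterᵇ (isStirling n) (words (2 * n) n)

-- statistics, with the convention σ_0 = σ_{2n+1} = 0
des : List ℕ → ℕ
des w = countᵇ (λ { (a , b) → b <ᵇ a }) (pairs (w ++ [ 0 ]))

asc : List ℕ → ℕ
asc w = countᵇ (λ { (a , b) → a <ᵇ b }) (pairs (0 ∷ w))

plat : List ℕ → ℕ
plat w = countᵇ (λ { (a , b) → a ≡ᵇ b }) (pairs (w ++ [ 0 ]))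

-- Labelled rooted plane trees (children ordered in a list)

data Tree : Set where
  node : ℕ → List Tree → Tree

mutual
  labels : Tree → List ℕ
  labels (node l cs) = l ∷ labelsF cs

  labelsF : List Tree → List ℕ
  labelsF [] = []
  labelsF (t ∷ ts) = labels t ++ labelsF ts

root : Tree → ℕ
root (node l _) = l

mutual
  isIncreasing : Tree → Bool
  isIncreasing (node l cs) = incrF l cs

  incrF : ℕ → List Tree → Bool
  incrF l [] = true
  incrF l (t ∷ ts) = (l <ᵇ root t) ∧ isIncreasing t ∧ incrF l ts

mutual
  atMost3 : Tree → Bool
  atMost3 (node l cs) = (length cs <ᵇ 4) ∧ atMost3F cs

  atMost3F : List Tree → Bool
  atMost3F [] = true
  atMost3F (t ∷ ts) = atMost3 t ∧ atMost3F ts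

mutual
  degCount : ℕ → Tree → ℕ
  degCount d (node l cs) = (if length cs ≡ᵇ d then 1 else 0) + degCountF d cs

  degCountF : ℕ → List Tree → ℕ
  degCountF d [] = 0
  degCountF d (t ∷ ts) = degCount d t + degCountF d ts

is0123IPT : ℕ → Tree → Bool
is0123IPT n t =
  (length (labels t) ≡ᵇ n) ∧
  allᵇ (λ j → occ j (labels t) ≡ᵇ 1) (range n) ∧
  isIncreasing t ∧
  atMost3 t

listsOfLen : ℕ → List Tree → List (List Tree)
listsOfLen zero ts = [ [] ]
listsOfLen (suc k) ts = concatMap (λ t → map (t ∷_) (listsOfLen k ts)) ts

-- all plane trees of depth ≤ d (counted in vertices), labels in {1,…,n},
-- every vertex with at most 3 children; each such tree occurs exactly once
treesUpTo : ℕ → ℕ → List Tree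
treesUpTo n zero = []
treesUpTo n (suc d) =
  concatMap (λ l → map (node l)
    (concatMap (λ k → listsOfLen k (treesUpTo n d)) (range0 3)))
  (range n)

-- the (finite) set of 0-1-2-3 increasing plane trees on [n]
-- (such a tree has n vertices, hence depth ≤ n)
IPT0123 : ℕ → List Tree
IPT0123 n = filterᵇ (is0123IPT n) (treesUpTo n n)

γ : ℕ → ℕ → ℕ → ℕ → ℕ
γ n i j k = countᵇ
  (λ t → (degCount 2 t ≡ᵇ i) ∧ (degCount 1 t ≡ᵇ j) ∧ (degCount 0 t ≡ᵇ k))
  (IPT0123 n)

triples : ℕ → List (ℕ × ℕ × ℕ)
triples n =
  filterᵇ (λ { (i , j , k) → (i + 2 * j + 3 * k) ≡ᵇ (2 * n + 1) })
    (concatMap (λ i → concatMap (λ j → map (λ k → (i , j , k))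
      (range0 (2 * n + 1))) (range0 (2 * n + 1))) (range0 (2 * n + 1)))

-- Polynomial expressions evaluated in an arbitrary commutative semiring.
-- An identity holding in every commutative semiring for all x y z is
-- exactly an identity in ℕ[x,y,z].

module Poly {c ℓ : Level} (R : CommutativeSemiring c ℓ) where
  open CommutativeSemiring R hiding (_+_; _*_)
  open CommutativeSemiring R using () renaming (_+_ to _⊕_; _*_ to _⊗_)
  open RSDefs rawSemiring using (_^_) renaming (_×_ to _·_)

  sumR : List Carrier → Carrier
  sumR = foldr _⊕_ 0#

  C : ℕ → Carrier → Carrier → Carrier → Carrier
  C n x y z = sumR (map (λ σ → (x ^ des σ) ⊗ (y ^ asc σ) ⊗ (z ^ plat σ)) (Q n))

  e₁ e₂ e₃ : Carrier → Carrier → Carrier → Carrier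
  e₁ x y z = x ⊕ y ⊕ z
  e₂ x y z = (x ⊗ y) ⊕ (x ⊗ z) ⊕ (y ⊗ z)
  e₃ x y z = x ⊗ y ⊗ z

  γExpansion : ℕ → Carrier → Carrier → Carrier → Carrier
  γExpansion n x y z = sumR (map
    (λ { (i , j , k) → γ n i j k · ((e₁ x y z ^ i) ⊗ (e₂ x y z ^ j) ⊗ (e₃ x y z ^ k)) })
    (triples n))

-- Both sides satisfy F₁ = xyz and F_{n+1} = xyz · D F_n for the derivation D = ∂ₓ + ∂_y + ∂_z.
--
-- Stirling side: write the monomial of σ ∈ Q_n as the product, over the 2n+1 gaps (σᵢ, σᵢ₊₁)
-- of 0σ0, of x, y or z according as the gap is a descent, an ascent or a plateau.  The
-- permutations in Q_{n+1} arise exactly once each by inserting (n+1)(n+1) into a gap of some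
-- σ ∈ Q_n; the gap (a, b) becomes (a, n+1), (n+1, n+1), (n+1, b), i.e. its weight is replaced
-- by yzx.  Summing over the gaps gives xyz · D applied to the monomial.
--
-- Tree side: give a vertex of degree 0, 1, 2, 3 the weight e₃, e₂, e₁, 1, so that a tree
-- contributes e₁^i e₂^j e₃^k and the γ-expansion is the sum of the weights of the trees.
-- The trees on [n+1] arise exactly once each by attaching the leaf n+1 to a tree on [n]; a
-- vertex of degree d offers d+1 positions, and (d+1) · w_{d+1} · e₃ = e₃ · D w_d because
-- D e₃ = e₂, D e₂ = 2e₁, D e₁ = 3.  By the Leibniz rule the sum over all attachments is
-- e₃ · D applied to the weight of the tree.
--
-- D is realised as the ε-part of evaluation in the dual numbers R[ε]/(ε²) at x+ε, y+ε, z+ε,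
-- so the induction on n runs over all commutative semirings simultaneously.

module Submission where

open import Defs
open import Level using (Level)
open import Data.Nat using (ℕ; _≤_)
open import Algebra.Bundles using (CommutativeSemiring)
open import Data.Nat using (suc; z≤n; s≤s)
open import Data.Product using (proj₂)

module ListLemmas where

  open import Data.Nat as ℕ using (ℕ; suc; _<_; s≤s; z<s)
  open import Data.Nat.Properties as ℕP using ()
  open import Data.Bool using (Bool; true; false; _∧_; not; if_then_else_; T)
  open import Data.Unit using (tt)
  open import Data.Empty using (⊥-elim)
  open import Data.Product using (Σ-syntax; _×_; _,_; proj₁; proj₂)
  open import Data.Sum using (inj₁; inj₂)
  open import Data.List using (List; []; _∷_; map; _++_; concatMap; length)
  open import Data.List.Properties using (length-++; ∷-injectiveˡ; ∷-injectiveʳ)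
  open import Data.List.Membership.Propositional using (_∈_; _∉_)
  open import Data.List.Membership.Propositional.Properties using (∈-++⁺ˡ; ∈-++⁺ʳ; ∈-++⁻; ∈-map⁺; ∈-map⁻; ∈-upTo⁺; ∈-upTo⁻)
  open import Data.List.Relation.Unary.Any using (here; there)
  open import Data.List.Relation.Unary.All as All using ([]; _∷_)
  open import Data.List.Relation.Unary.Unique.Propositional using (Unique)
  open import Data.List.Relation.Unary.AllPairs using ([]; _∷_)
  import Data.List.Relation.Unary.Unique.Propositional.Properties as Unique
  open import Data.List.Relation.Binary.Permutation.Propositional using (_↭_)
  open import Data.List.Membership.Propositional.Properties.WithK using (unique∧set⇒bag)
  open import Data.List.Relation.Binary.BagAndSetEquality using (∼bag⇒↭)
  open import Function.Bundles using (mk⇔)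
  open import Relation.Binary.PropositionalEquality using (_≡_; _≢_; refl; sym; trans; cong; subst)
  open import Relation.Nullary using (¬_)

  T-∧⁺ : ∀ {a b} → T a → T b → T (a ∧ b)
  T-∧⁺ {true} {true} _ _ = tt

  T-∧⁻ˡ : ∀ {a b} → T (a ∧ b) → T a
  T-∧⁻ˡ {true} _ = tt

  T-∧⁻ʳ : ∀ {a b} → T (a ∧ b) → T b
  T-∧⁻ʳ {true} {true} _ = tt

  T-not⁻ : ∀ {b} → T (not b) → ¬ T b
  T-not⁻ {false} _ ()

  T-not⁺ : ∀ {b} → ¬ T b → T (not b)
  T-not⁺ {false} _ = tt
  T-not⁺ {true} h = h tt

  ≡ᵇ⇒≡ : ∀ {m n} → T (m ℕ.≡ᵇ n) → m ≡ n
  ≡ᵇ⇒≡ {m} {n} = ℕP.≡ᵇ⇒≡ m n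

  ≡⇒≡ᵇ : ∀ {m n} → m ≡ n → T (m ℕ.≡ᵇ n)
  ≡⇒≡ᵇ {m} {n} = ℕP.≡⇒≡ᵇ m n

  <ᵇ⇒< : ∀ {m n} → T (m ℕ.<ᵇ n) → m < n
  <ᵇ⇒< {m} {n} = ℕP.<ᵇ⇒< m n

  <⇒<ᵇ : ∀ {m n} → m < n → T (m ℕ.<ᵇ n)
  <⇒<ᵇ = ℕP.<⇒<ᵇ

  if-T : ∀ {ℓ} {A : Set ℓ} {b} {u v : A} → T b → (if b then u else v) ≡ u
  if-T {b = true} _ = refl

  if-¬T : ∀ {ℓ} {A : Set ℓ} {b} {u v : A} → ¬ T b → (if b then u else v) ≡ v
  if-¬T {b = true} h = ⊥-elim (h tt)
  if-¬T {b = false} _ = refl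

  ∈-filterᵇ⁺ : ∀ {A : Set} (p : A → Bool) {x : A} {xs} → x ∈ xs → T (p x) → x ∈ filterᵇ p xs
  ∈-filterᵇ⁺ p {xs = a ∷ xs} (here refl) px with p a
  ... | true = here refl
  ∈-filterᵇ⁺ p {xs = a ∷ xs} (there x∈xs) px with p a
  ... | true = there (∈-filterᵇ⁺ p x∈xs px)
  ... | false = ∈-filterᵇ⁺ p x∈xs px

  ∈-filterᵇ⁻ : ∀ {A : Set} (p : A → Bool) {x : A} xs → x ∈ filterᵇ p xs → x ∈ xs × T (p x)
  ∈-filterᵇ⁻ p (a ∷ xs) x∈ with p a in eq
  ∈-filterᵇ⁻ p (a ∷ xs) (here refl) | true = here refl , subst T (sym eq) tt
  ∈-filterᵇ⁻ p (a ∷ xs) (there x∈) | true = let (x∈xs , px) = ∈-filterᵇ⁻ p xs x∈ in there x∈xs , px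
  ∈-filterᵇ⁻ p (a ∷ xs) x∈ | false = let (x∈xs , px) = ∈-filterᵇ⁻ p xs x∈ in there x∈xs , px

  filterᵇ-unique : ∀ {A : Set} (p : A → Bool) {xs : List A} → Unique xs → Unique (filterᵇ p xs)
  filterᵇ-unique p [] = []
  filterᵇ-unique p {a ∷ xs} (a∉ ∷ u) with p a
  ... | true = All.tabulate (λ x∈ → All.lookup a∉ (proj₁ (∈-filterᵇ⁻ p xs x∈))) ∷ filterᵇ-unique p u
  ... | false = filterᵇ-unique p u

  filterᵇ-++ : ∀ {A : Set} (p : A → Bool) xs ys → filterᵇ p (xs ++ ys) ≡ filterᵇ p xs ++ filterᵇ p ys
  filterᵇ-++ p [] ys = refl
  filterᵇ-++ p (a ∷ xs) ys with p a
  ... | true = cong (a ∷_) (filterᵇ-++ p xs ys)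
  ... | false = filterᵇ-++ p xs ys

  countᵇ-++ : ∀ {A : Set} (p : A → Bool) xs ys → countᵇ p (xs ++ ys) ≡ countᵇ p xs ℕ.+ countᵇ p ys
  countᵇ-++ p xs ys = trans (cong length (filterᵇ-++ p xs ys)) (length-++ (filterᵇ p xs))

  indicator : Bool → ℕ
  indicator b = if b then 1 else 0

  countᵇ-∷ : ∀ {A : Set} (p : A → Bool) a xs → countᵇ p (a ∷ xs) ≡ indicator (p a) ℕ.+ countᵇ p xs
  countᵇ-∷ p a xs with p a
  ... | true = refl
  ... | false = refl

  countᵇ-∷-¬T : ∀ {A : Set} (p : A → Bool) a xs → ¬ T (p a) → countᵇ p (a ∷ xs) ≡ countᵇ p xs
  countᵇ-∷-¬T p a xs ¬pa = cong length (if-¬T ¬pa)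

  allᵇ⁻ : ∀ {A : Set} {p : A → Bool} {xs} → T (allᵇ p xs) → ∀ {x} → x ∈ xs → T (p x)
  allᵇ⁻ {xs = a ∷ xs} h (here refl) = T-∧⁻ˡ h
  allᵇ⁻ {p = p} {xs = a ∷ xs} h (there x∈) = allᵇ⁻ (T-∧⁻ʳ {p a} h) x∈

  allᵇ⁺ : ∀ {A : Set} {p : A → Bool} {xs} → (∀ {x} → x ∈ xs → T (p x)) → T (allᵇ p xs)
  allᵇ⁺ {xs = []} h = tt
  allᵇ⁺ {xs = a ∷ xs} h = T-∧⁺ (h (here refl)) (allᵇ⁺ (λ x∈ → h (there x∈)))

  ∈-concatMap⁺ : ∀ {A B : Set} (g : A → List B) {a b xs} → a ∈ xs → b ∈ g a → b ∈ concatMap g xs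
  ∈-concatMap⁺ g {xs = x ∷ xs} (here refl) b∈ = ∈-++⁺ˡ b∈
  ∈-concatMap⁺ g {xs = x ∷ xs} (there a∈) b∈ = ∈-++⁺ʳ (g x) (∈-concatMap⁺ g a∈ b∈)

  ∈-concatMap⁻ : ∀ {A B : Set} (g : A → List B) {b} xs → b ∈ concatMap g xs → Σ[ a ∈ A ] (a ∈ xs × b ∈ g a)
  ∈-concatMap⁻ g (x ∷ xs) b∈ with ∈-++⁻ (g x) b∈
  ... | inj₁ b∈gx = x , here refl , b∈gx
  ... | inj₂ b∈rest = let (a , a∈ , b∈ga) = ∈-concatMap⁻ g xs b∈rest in a , there a∈ , b∈ga

  concatMap-unique : ∀ {A B : Set} (g : A → List B) (key : B → A) {xs} → Unique xs →
    (∀ {a} → a ∈ xs → Unique (g a)) →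
    (∀ {a b} → a ∈ xs → b ∈ g a → key b ≡ a) →
    Unique (concatMap g xs)
  concatMap-unique g key {[]} _ _ _ = []
  concatMap-unique g key {x ∷ xs} (x∉ ∷ u) ug k =
    Unique.++⁺ (ug (here refl)) (concatMap-unique g key u (λ a∈ → ug (there a∈)) (λ a∈ → k (there a∈)))
      λ (b∈gx , b∈rest) → let (a , a∈ , b∈ga) = ∈-concatMap⁻ g xs b∈rest in
         All.lookup x∉ a∈ (trans (sym (k (here refl) b∈gx)) (k (there a∈) b∈ga))

  concatMap-map-unique : ∀ {A B C : Set} (f : A → B → C) →
    (∀ {a a′ b b′} → f a b ≡ f a′ b′ → a ≡ a′ × b ≡ b′) →
    ∀ {xs ys} → Unique xs → Unique ys → Unique (concatMap (λ a → map (f a) ys) xs)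
  concatMap-map-unique f f-inj {[]} _ _ = []
  concatMap-map-unique f f-inj {x ∷ xs} {ys} (x∉ ∷ uxs) uys =
    Unique.++⁺ (Unique.map⁺ (λ e → proj₂ (f-inj e)) uys) (concatMap-map-unique f f-inj uxs uys)
      λ (c∈₁ , c∈₂) → let (_ , _ , e₁) = ∈-map⁻ (f x) c∈₁
                          (a , a∈ , c∈) = ∈-concatMap⁻ (λ a → map (f a) ys) xs c∈₂
                          (_ , _ , e₂) = ∈-map⁻ (f a) c∈ in
        All.lookup x∉ a∈ (proj₁ (f-inj (trans (sym e₁) e₂)))

  unique∧set⇒↭ : ∀ {A : Set} {xs ys : List A} → Unique xs → Unique ys →
    (∀ {x} → x ∈ xs → x ∈ ys) → (∀ {x} → x ∈ ys → x ∈ xs) → xs ↭ ys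
  unique∧set⇒↭ ux uy f g = ∼bag⇒↭ (unique∧set⇒bag ux uy (mk⇔ f g))

  ∈-range⁻ : ∀ {k a} → a ∈ range k → 0 < a × a < suc k
  ∈-range⁻ a∈ with ∈-map⁻ suc a∈
  ... | _ , i∈ , refl = z<s , s≤s (∈-upTo⁻ i∈)

  ∈-range⁺ : ∀ {k a} → 0 < a → a < suc k → a ∈ range k
  ∈-range⁺ {a = suc a} _ (s≤s a<) = ∈-map⁺ suc (∈-upTo⁺ a<)

  max∈range : ∀ k → suc k ∈ range (suc k)
  max∈range k = ∈-range⁺ z<s ℕP.≤-refl

  ∈-range-suc : ∀ {k a} → a ∈ range k → a ∈ range (suc k)
  ∈-range-suc a∈ = let (0<a , a≤k) = ∈-range⁻ a∈ in ∈-range⁺ 0<a (ℕP.m<n⇒m<1+n a≤k)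

  ∈-range-pred : ∀ {k a} → a ∈ range (suc k) → a ≢ suc k → a ∈ range k
  ∈-range-pred a∈ a≢ = let (0<a , a<) = ∈-range⁻ a∈ in ∈-range⁺ 0<a (ℕP.≤∧≢⇒< (ℕP.≤-pred a<) a≢)

  range-unique : ∀ k → Unique (range k)
  range-unique k = Unique.map⁺ ℕP.suc-injective (Unique.upTo⁺ k)

  insertions : {A : Set} → A → List A → List (List A)
  insertions u [] = (u ∷ []) ∷ []
  insertions u (a ∷ as) = (u ∷ a ∷ as) ∷ map (a ∷_) (insertions u as)

  ∈-insertions⁻ : ∀ {A : Set} (u : A) as {bs} → bs ∈ insertions u as →
    Σ[ p ∈ List A ] Σ[ s ∈ List A ] (as ≡ p ++ s × bs ≡ p ++ u ∷ s)
  ∈-insertions⁻ u [] (here refl) = [] , [] , refl , refl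
  ∈-insertions⁻ u (a ∷ as) (here refl) = [] , a ∷ as , refl , refl
  ∈-insertions⁻ u (a ∷ as) (there bs∈) with ∈-map⁻ (a ∷_) bs∈
  ... | _ , bs′∈ , refl with ∈-insertions⁻ u as bs′∈
  ...   | p , s , refl , refl = a ∷ p , s , refl , refl

  ∈-insertions⁺ : ∀ {A : Set} (u : A) p s → (p ++ u ∷ s) ∈ insertions u (p ++ s)
  ∈-insertions⁺ u [] [] = here refl
  ∈-insertions⁺ u [] (a ∷ s) = here refl
  ∈-insertions⁺ u (a ∷ p) s = there (∈-map⁺ (a ∷_) (∈-insertions⁺ u p s))

  insertions-unique : ∀ {A : Set} (u : A) as → u ∉ as → Unique (insertions u as)
  insertions-unique u [] _ = [] ∷ []
  insertions-unique u (a ∷ as) u∉ =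
    All.tabulate (λ bs∈ e → let (_ , _ , e′) = ∈-map⁻ (a ∷_) bs∈ in u∉ (here (∷-injectiveˡ (trans e e′))))
    ∷ Unique.map⁺ ∷-injectiveʳ (insertions-unique u as (λ u∈ → u∉ (there u∈)))

  length-insertions : ∀ {A : Set} (u : A) as {bs} → bs ∈ insertions u as → length bs ≡ suc (length as)
  length-insertions u as bs∈ with ∈-insertions⁻ u as bs∈
  ... | p , s , refl , refl = trans (length-++ p) (trans (ℕP.+-suc _ _) (cong suc (sym (length-++ p))))

module Sums {c ℓ : Level} (R : CommutativeSemiring c ℓ) where

  open import Data.Bool using (Bool; T)
  open import Data.List using (List; []; _∷_; map; _++_; concatMap)
  open import Data.List.Membership.Propositional using (_∈_; _∉_)
  open import Data.List.Relation.Unary.Any using (here; there)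
  open import Data.List.Relation.Unary.All as All using ([]; _∷_)
  open import Data.List.Relation.Unary.Unique.Propositional using (Unique)
  open import Data.List.Relation.Unary.AllPairs using ([]; _∷_)
  open import Data.List.Relation.Binary.Permutation.Propositional as Perm using (_↭_)
  import Relation.Binary.PropositionalEquality as P
  open CommutativeSemiring R
  open import Algebra.Definitions.RawSemiring rawSemiring using () renaming (_×_ to _·_)
  open import Algebra.Properties.Semiring.Mult semiring using (×-homo-+; ×-homo-1)
  open import Algebra.Solver.Ring.NaturalCoefficients.Default R
  open ListLemmas using (indicator; countᵇ-∷; if-T; if-¬T)
  open Poly R using (sumR)

  ∑ : {A : Set} → List A → (A → Carrier) → Carrier
  ∑ xs f = sumR (map f xs)

  ∑-cong : {A : Set} (xs : List A) {f g : A → Carrier} → (∀ {a} → a ∈ xs → f a ≈ g a) → ∑ xs f ≈ ∑ xs g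
  ∑-cong [] _ = refl
  ∑-cong (a ∷ xs) f≈g = +-cong (f≈g (here P.refl)) (∑-cong xs (λ a∈ → f≈g (there a∈)))

  ∑-++ : {A : Set} (xs ys : List A) (f : A → Carrier) → ∑ (xs ++ ys) f ≈ ∑ xs f + ∑ ys f
  ∑-++ [] ys f = sym (+-identityˡ _)
  ∑-++ (a ∷ xs) ys f = trans (+-congˡ (∑-++ xs ys f)) (sym (+-assoc _ _ _))

  ∑-concatMap : {A B : Set} (xs : List A) (g : A → List B) (f : B → Carrier) →
    ∑ (concatMap g xs) f ≈ ∑ xs (λ a → ∑ (g a) f)
  ∑-concatMap [] g f = refl
  ∑-concatMap (a ∷ xs) g f = trans (∑-++ (g a) (concatMap g xs) f) (+-congˡ (∑-concatMap xs g f))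

  ∑-map : {A B : Set} (xs : List A) (g : A → B) (f : B → Carrier) → ∑ (map g xs) f ≈ ∑ xs (λ a → f (g a))
  ∑-map [] g f = refl
  ∑-map (a ∷ xs) g f = +-congˡ (∑-map xs g f)

  *-distribˡ-∑ : {A : Set} (xs : List A) (k : Carrier) (f : A → Carrier) → k * ∑ xs f ≈ ∑ xs (λ a → k * f a)
  *-distribˡ-∑ [] k f = zeroʳ k
  *-distribˡ-∑ (a ∷ xs) k f = trans (distribˡ k _ _) (+-congˡ (*-distribˡ-∑ xs k f))

  ∑-+ : {A : Set} (xs : List A) (f g : A → Carrier) → ∑ xs (λ a → f a + g a) ≈ ∑ xs f + ∑ xs g
  ∑-+ [] f g = sym (+-identityˡ _)
  ∑-+ (a ∷ xs) f g = trans (+-congˡ (∑-+ xs f g))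
    (solve 4 (λ p q r s → (p :+ q) :+ (r :+ s) := (p :+ r) :+ (q :+ s)) refl _ _ _ _)

  ∑-↭ : {A : Set} {xs ys : List A} (f : A → Carrier) → xs ↭ ys → ∑ xs f ≈ ∑ ys f
  ∑-↭ f Perm.refl = refl
  ∑-↭ f (Perm.prep x p) = +-congˡ (∑-↭ f p)
  ∑-↭ f (Perm.swap x y p) = trans (+-congˡ (+-congˡ (∑-↭ f p)))
    (solve 3 (λ p q r → p :+ (q :+ r) := q :+ (p :+ r)) refl _ _ _)
  ∑-↭ f (Perm.trans p q) = trans (∑-↭ f p) (∑-↭ f q)

  ∑-0 : {A : Set} (xs : List A) → ∑ xs (λ _ → 0#) ≈ 0#
  ∑-0 [] = refl
  ∑-0 (a ∷ xs) = trans (+-identityˡ _) (∑-0 xs)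

  module _ {A : Set} (_==_ : A → A → Bool) (==⇒≡ : ∀ {a b} → T (a == b) → a P.≡ b) (==-refl : ∀ a → T (a == a))
           (g : A → Carrier) where

    ∑-indicator-∉ : ∀ {a₀} as → a₀ ∉ as → ∑ as (λ a → indicator (a₀ == a) · g a) ≈ 0#
    ∑-indicator-∉ [] _ = refl
    ∑-indicator-∉ (a ∷ as) a₀∉ =
      trans (+-cong (reflexive (P.cong (_· g a) (if-¬T (λ t → a₀∉ (here (==⇒≡ t)))))) (∑-indicator-∉ as (λ a₀∈ → a₀∉ (there a₀∈))))
        (+-identityˡ _)

    ∑-indicator : ∀ {a₀} as → Unique as → a₀ ∈ as → ∑ as (λ a → indicator (a₀ == a) · g a) ≈ g a₀
    ∑-indicator (a ∷ as) (a∉ ∷ _) (here P.refl) =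
      trans (+-cong (trans (reflexive (P.cong (_· g a) (if-T (==-refl a)))) (×-homo-1 (g a)))
                    (∑-indicator-∉ as (λ a∈ → All.lookup a∉ a∈ P.refl)))
        (+-identityʳ _)
    ∑-indicator (a ∷ as) (a∉ ∷ u) (there a₀∈) =
      trans (+-cong (reflexive (P.cong (_· g a) (if-¬T (λ t → All.lookup a∉ a₀∈ (P.sym (==⇒≡ t)))))) (∑-indicator as u a₀∈))
        (+-identityˡ _)

    ∑-fibres : ∀ {B : Set} (f : B → A) as bs → Unique as → (∀ {b} → b ∈ bs → f b ∈ as) →
      ∑ as (λ a → countᵇ (λ b → f b == a) bs · g a) ≈ ∑ bs (λ b → g (f b))
    ∑-fibres f as [] _ _ = ∑-0 as
    ∑-fibres f as (b ∷ bs) u f∈ =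
      trans (∑-cong as (λ {a} _ → trans (reflexive (P.cong (_· g a) (countᵇ-∷ (λ b → f b == a) b bs)))
                                       (×-homo-+ (g a) (indicator (f b == a)) (countᵇ (λ b → f b == a) bs))))
        (trans (∑-+ as _ _) (+-cong (∑-indicator as u (f∈ (here P.refl))) (∑-fibres f as bs u (λ b∈ → f∈ (there b∈)))))

-- The dual numbers R[ε] with ε² = 0.  For a polynomial expression f built from the semiring
-- operations, the ε-part of f (x + ε, y + ε, z + ε) is (∂ₓ + ∂_y + ∂_z) f at (x, y, z).
module DualNumbers {c ℓ : Level} (R : CommutativeSemiring c ℓ) where

  open import Data.Product using (_×_; _,_; proj₁; proj₂)
  open import Data.List using (List; []; _∷_; map)
  open import Algebra.Structures.Biased using (IsCommutativeSemiringˡ)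
  open import Relation.Binary.Structures using (IsEquivalence)
  import Relation.Binary.PropositionalEquality as P
  open CommutativeSemiring R
  open import Algebra.Solver.Ring.NaturalCoefficients.Default R

  private
    D : Set c
    D = Carrier × Carrier

    _≈ᴰ_ : D → D → Set ℓ
    p ≈ᴰ q = (proj₁ p ≈ proj₁ q) × (proj₂ p ≈ proj₂ q)

    _+ᴰ_ : D → D → D
    p +ᴰ q = (proj₁ p + proj₁ q , proj₂ p + proj₂ q)

    _*ᴰ_ : D → D → D
    p *ᴰ q = (proj₁ p * proj₁ q , proj₁ p * proj₂ q + proj₂ p * proj₁ q)

    isEquivalenceᴰ : IsEquivalence _≈ᴰ_
    isEquivalenceᴰ = record
      { refl = refl , refl
      ; sym = λ (a , b) → sym a , sym b
      ; trans = λ (a , b) (c , d) → trans a c , trans b d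
      }

    isCommutativeSemiringᴰ : IsCommutativeSemiringˡ _≈ᴰ_ _+ᴰ_ _*ᴰ_ (0# , 0#) (1# , 0#)
    isCommutativeSemiringᴰ = record
      { +-isCommutativeMonoid = record
        { isMonoid = record
          { isSemigroup = record
            { isMagma = record
              { isEquivalence = isEquivalenceᴰ
              ; ∙-cong = λ (a , b) (c , d) → +-cong a c , +-cong b d }
            ; assoc = λ _ _ _ → +-assoc _ _ _ , +-assoc _ _ _ }
          ; identity = (λ _ → +-identityˡ _ , +-identityˡ _) , (λ _ → +-identityʳ _ , +-identityʳ _) }
        ; comm = λ _ _ → +-comm _ _ , +-comm _ _ }
      ; *-isCommutativeMonoid = record
        { isMonoid = record
          { isSemigroup = record
            { isMagma = record
              { isEquivalence = isEquivalenceᴰ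
              ; ∙-cong = λ (a , b) (c , d) → *-cong a c , +-cong (*-cong a d) (*-cong b c) }
            ; assoc = λ (p₁ , p₂) (q₁ , q₂) (r₁ , r₂) → *-assoc _ _ _ ,
                solve 6 (λ p₁ p₂ q₁ q₂ r₁ r₂ → (p₁ :* q₁) :* r₂ :+ (p₁ :* q₂ :+ p₂ :* q₁) :* r₁
                                              := p₁ :* (q₁ :* r₂ :+ q₂ :* r₁) :+ p₂ :* (q₁ :* r₁))
                  refl p₁ p₂ q₁ q₂ r₁ r₂ }
          ; identity =
              (λ (a , b) → *-identityˡ _ , solve 2 (λ a b → con 1 :* b :+ con 0 :* a := b) refl a b) ,
              (λ (a , b) → *-identityʳ _ , solve 2 (λ a b → a :* con 0 :+ b :* con 1 := b) refl a b) }
        ; comm = λ (a , b) (c , d) → *-comm _ _ ,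
            solve 4 (λ a b c d → a :* d :+ b :* c := c :* b :+ d :* a) refl a b c d }
      ; distribʳ = λ (a , b) (c , d) (e , f) → distribʳ _ _ _ ,
          solve 6 (λ a b c d e f → (c :+ e) :* b :+ (d :+ f) :* a := (c :* b :+ d :* a) :+ (e :* b :+ f :* a))
            refl a b c d e f
      ; zeroˡ = λ (a , b) → zeroˡ _ , solve 2 (λ a b → con 0 :* b :+ con 0 :* a := con 0) refl a b
      }

  Dual : CommutativeSemiring c ℓ
  Dual = record { isCommutativeSemiring = IsCommutativeSemiringˡ.isCommutativeSemiring isCommutativeSemiringᴰ }

  _+ε : Carrier → Carrier × Carrier
  a +ε = (a , 1#)

  ε-part-sum : {A : Set} (xs : List A) (f : A → Carrier × Carrier) →
    proj₂ (Poly.sumR Dual (map f xs)) P.≡ Poly.sumR R (map (λ a → proj₂ (f a)) xs)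
  ε-part-sum [] f = P.refl
  ε-part-sum (a ∷ xs) f = P.cong (proj₂ (f a) +_) (ε-part-sum xs f)

module StirlingPermutations where

  open import Data.Nat as ℕ using (ℕ; zero; suc; _+_; _*_; _<_; z<s; _≟_)
  open import Data.Nat.Properties as ℕP using ()
  open import Data.Bool using (T; not; _∧_)
  open import Data.Product using (Σ-syntax; _×_; _,_; proj₁; proj₂)
  open import Data.Sum using (inj₁; inj₂; [_,_]′)
  open import Data.List using (List; []; _∷_; map; _++_; concatMap; length)
  open import Data.List.Properties using (length-++; ∷-injective; ∷-injectiveˡ; ∷-injectiveʳ)
  open import Data.List.Membership.Propositional using (_∈_; _∉_)
  open import Data.List.Membership.Propositional.Properties using (∈-map⁺; ∈-map⁻; ∈-++⁺ˡ; ∈-++⁺ʳ; ∈-++⁻)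
  open import Data.List.Relation.Unary.Any using (here; there)
  open import Data.List.Relation.Unary.All as All using ([]; _∷_)
  open import Data.List.Relation.Unary.Unique.Propositional using (Unique)
  open import Data.List.Relation.Unary.AllPairs using ([]; _∷_)
  import Data.List.Relation.Unary.Unique.Propositional.Properties as Unique
  open import Data.List.Relation.Binary.Permutation.Propositional using (_↭_)
  open import Relation.Binary.PropositionalEquality using (_≡_; _≢_; ≢-sym; refl; sym; trans; cong; cong₂; subst)
  open import Relation.Nullary using (yes; no)
  open ListLemmas

  ∈-words⁺ : ∀ m k w → length w ≡ m → (∀ {a} → a ∈ w → a ∈ range k) → w ∈ words m k
  ∈-words⁺ zero k [] refl _ = here refl
  ∈-words⁺ (suc m) k (a ∷ w) refl w⊆ =
    ∈-concatMap⁺ (λ b → map (b ∷_) (words m k)) (w⊆ (here refl))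
      (∈-map⁺ (a ∷_) (∈-words⁺ m k w refl (λ a∈ → w⊆ (there a∈))))

  ∈-words⁻ : ∀ m k {w} → w ∈ words m k → length w ≡ m × (∀ {a} → a ∈ w → a ∈ range k)
  ∈-words⁻ zero k (here refl) = refl , λ ()
  ∈-words⁻ (suc m) k w∈ with ∈-concatMap⁻ (λ b → map (b ∷_) (words m k)) (range k) w∈
  ... | b , b∈ , w∈′ with ∈-map⁻ (b ∷_) w∈′
  ... | w′ , w′∈ , refl =
    let (len , w′⊆) = ∈-words⁻ m k w′∈ in
    cong suc len , λ { (here refl) → b∈ ; (there a∈) → w′⊆ a∈ }

  words-unique : ∀ m k → Unique (words m k)
  words-unique zero k = [] ∷ []
  words-unique (suc m) k = concatMap-map-unique _∷_ ∷-injective (range-unique k) (words-unique m k)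

  record IsStirling (n : ℕ) (w : List ℕ) : Set where
    field
      length≡ : length w ≡ 2 * n
      bounded : ∀ {a} → a ∈ w → 0 < a × a < suc n
      twice   : ∀ {j} → j ∈ range n → occ j w ≡ 2
      nested  : ∀ {j} → j ∈ range n → ∀ {a} → a ∈ between j w → j < a

  isStirling⁻ : ∀ n w → T (isStirling n w) → IsStirling n w
  isStirling⁻ n w h = record
    { length≡ = ≡ᵇ⇒≡ (T-∧⁻ˡ h)
    ; bounded = λ {a} a∈ → let r = allᵇ⁻ (T-∧⁻ˡ h₂) a∈ in <ᵇ⇒< (T-∧⁻ˡ r) , <ᵇ⇒< (T-∧⁻ʳ {0 ℕ.<ᵇ a} r)
    ; twice = λ j∈ → ≡ᵇ⇒≡ (T-∧⁻ˡ (allᵇ⁻ h₃ j∈))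
    ; nested = λ j∈ a∈ → <ᵇ⇒< (allᵇ⁻ (T-∧⁻ʳ {occ _ w ℕ.≡ᵇ 2} (allᵇ⁻ h₃ j∈)) a∈)
    }
    where
    h₂ = T-∧⁻ʳ {length w ℕ.≡ᵇ 2 * n} h
    h₃ = T-∧⁻ʳ {allᵇ (λ a → (0 ℕ.<ᵇ a) ∧ (a ℕ.<ᵇ suc n)) w} h₂

  isStirling⁺ : ∀ n w → IsStirling n w → T (isStirling n w)
  isStirling⁺ n w s = T-∧⁺ (≡⇒≡ᵇ length≡)
    (T-∧⁺ (allᵇ⁺ (λ a∈ → T-∧⁺ (<⇒<ᵇ (proj₁ (bounded a∈))) (<⇒<ᵇ (proj₂ (bounded a∈)))))
          (allᵇ⁺ (λ j∈ → T-∧⁺ (≡⇒≡ᵇ (twice j∈)) (allᵇ⁺ (λ a∈ → <⇒<ᵇ (nested j∈ a∈))))))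
    where open IsStirling s

  ∈-Q⁻ : ∀ n {w} → w ∈ Q n → IsStirling n w
  ∈-Q⁻ n {w} w∈ = isStirling⁻ n w (proj₂ (∈-filterᵇ⁻ (isStirling n) (words (2 * n) n) w∈))

  ∈-Q⁺ : ∀ n {w} → IsStirling n w → w ∈ Q n
  ∈-Q⁺ n {w} s = ∈-filterᵇ⁺ (isStirling n)
    (∈-words⁺ (2 * n) n w (IsStirling.length≡ s)
      (λ a∈ → ∈-range⁺ (proj₁ (IsStirling.bounded s a∈)) (proj₂ (IsStirling.bounded s a∈))))
    (isStirling⁺ n w s)

  Q-unique : ∀ n → Unique (Q n)
  Q-unique n = filterᵇ-unique (isStirling n) (words-unique (2 * n) n)

  removeAll : ℕ → List ℕ → List ℕ
  removeAll m = filterᵇ (λ a → not (a ℕ.≡ᵇ m))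

  removeAll-≡ : ∀ m w → removeAll m (m ∷ w) ≡ removeAll m w
  removeAll-≡ m w = if-¬T (λ t → T-not⁻ t (≡⇒≡ᵇ {m} refl))

  removeAll-≢ : ∀ {a m} w → a ≢ m → removeAll m (a ∷ w) ≡ a ∷ removeAll m w
  removeAll-≢ w a≢m = if-T (T-not⁺ (λ t → a≢m (≡ᵇ⇒≡ t)))

  occ-≡ : ∀ j w → occ j (j ∷ w) ≡ suc (occ j w)
  occ-≡ j w = cong length (if-T (≡⇒≡ᵇ {j} refl))

  occ-≢ : ∀ {a j} w → a ≢ j → occ j (a ∷ w) ≡ occ j w
  occ-≢ w a≢j = cong length (if-¬T (λ t → a≢j (≡ᵇ⇒≡ t)))

  takeUntil-≡ : ∀ j w → takeUntil j (j ∷ w) ≡ []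
  takeUntil-≡ j w = if-T (≡⇒≡ᵇ {j} refl)

  takeUntil-≢ : ∀ {a j} w → a ≢ j → takeUntil j (a ∷ w) ≡ a ∷ takeUntil j w
  takeUntil-≢ w a≢j = if-¬T (λ t → a≢j (≡ᵇ⇒≡ t))

  dropUntil-≡ : ∀ j w → dropUntil j (j ∷ w) ≡ w
  dropUntil-≡ j w = if-T (≡⇒≡ᵇ {j} refl)

  dropUntil-≢ : ∀ {a j} w → a ≢ j → dropUntil j (a ∷ w) ≡ dropUntil j w
  dropUntil-≢ w a≢j = if-¬T (λ t → a≢j (≡ᵇ⇒≡ t))

  occ-removeAll : ∀ {j m} → j ≢ m → ∀ w → occ j (removeAll m w) ≡ occ j w
  occ-removeAll j≢m [] = refl
  occ-removeAll {j} {m} j≢m (a ∷ w) with a ≟ m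
  ... | yes refl = trans (cong (occ j) (removeAll-≡ a w))
                     (trans (occ-removeAll j≢m w) (sym (occ-≢ w (≢-sym j≢m))))
  ... | no a≢m with a ≟ j
  ...   | yes refl = trans (cong (occ j) (removeAll-≢ w a≢m))
                       (trans (occ-≡ a (removeAll m w)) (trans (cong suc (occ-removeAll j≢m w)) (sym (occ-≡ a w))))
  ...   | no a≢j = trans (cong (occ j) (removeAll-≢ w a≢m))
                     (trans (occ-≢ (removeAll m w) a≢j) (trans (occ-removeAll j≢m w) (sym (occ-≢ w a≢j))))

  takeUntil-removeAll : ∀ {j m} → j ≢ m → ∀ w → takeUntil j (removeAll m w) ≡ removeAll m (takeUntil j w)
  takeUntil-removeAll j≢m [] = refl
  takeUntil-removeAll {j} {m} j≢m (a ∷ w) with a ≟ m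
  ... | yes refl = trans (cong (takeUntil j) (removeAll-≡ a w)) (trans (takeUntil-removeAll j≢m w)
                     (trans (sym (removeAll-≡ a (takeUntil j w))) (cong (removeAll a) (sym (takeUntil-≢ w (≢-sym j≢m))))))
  ... | no a≢m with a ≟ j
  ...   | yes refl = trans (cong (takeUntil a) (removeAll-≢ w a≢m))
                       (trans (takeUntil-≡ a (removeAll m w)) (cong (removeAll m) (sym (takeUntil-≡ a w))))
  ...   | no a≢j = trans (cong (takeUntil j) (removeAll-≢ w a≢m)) (trans (takeUntil-≢ (removeAll m w) a≢j)
                     (trans (cong (a ∷_) (takeUntil-removeAll j≢m w))
                       (trans (sym (removeAll-≢ (takeUntil j w) a≢m)) (cong (removeAll m) (sym (takeUntil-≢ w a≢j))))))

  dropUntil-removeAll : ∀ {j m} → j ≢ m → ∀ w → dropUntil j (removeAll m w) ≡ removeAll m (dropUntil j w)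
  dropUntil-removeAll j≢m [] = refl
  dropUntil-removeAll {j} {m} j≢m (a ∷ w) with a ≟ m
  ... | yes refl = trans (cong (dropUntil j) (removeAll-≡ a w))
                     (trans (dropUntil-removeAll j≢m w) (cong (removeAll a) (sym (dropUntil-≢ w (≢-sym j≢m)))))
  ... | no a≢m with a ≟ j
  ...   | yes refl = trans (cong (dropUntil a) (removeAll-≢ w a≢m))
                       (trans (dropUntil-≡ a (removeAll m w)) (cong (removeAll m) (sym (dropUntil-≡ a w))))
  ...   | no a≢j = trans (cong (dropUntil j) (removeAll-≢ w a≢m)) (trans (dropUntil-≢ (removeAll m w) a≢j)
                     (trans (dropUntil-removeAll j≢m w) (cong (removeAll m) (sym (dropUntil-≢ w a≢j)))))

  between-removeAll : ∀ {j m} → j ≢ m → ∀ w → between j (removeAll m w) ≡ removeAll m (between j w)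
  between-removeAll {j} j≢m w =
    trans (cong (takeUntil j) (dropUntil-removeAll j≢m w)) (takeUntil-removeAll j≢m (dropUntil j w))

  removeAll-∉ : ∀ {m} w → m ∉ w → removeAll m w ≡ w
  removeAll-∉ [] _ = refl
  removeAll-∉ (a ∷ w) m∉ =
    trans (removeAll-≢ w (λ e → m∉ (here (sym e)))) (cong (a ∷_) (removeAll-∉ w (λ m∈ → m∉ (there m∈))))

  occ-∉ : ∀ {j} w → j ∉ w → occ j w ≡ 0
  occ-∉ [] _ = refl
  occ-∉ (a ∷ w) j∉ = trans (occ-≢ w (λ e → j∉ (here (sym e)))) (occ-∉ w (λ j∈ → j∉ (there j∈)))

  occ≡0⇒∉ : ∀ {j} w → occ j w ≡ 0 → j ∉ w
  occ≡0⇒∉ (a ∷ w) e (here refl) with () ← trans (sym (occ-≡ a w)) e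
  occ≡0⇒∉ {j} (a ∷ w) e (there j∈) with a ≟ j
  ... | yes refl with () ← trans (sym (occ-≡ a w)) e
  ... | no a≢j = occ≡0⇒∉ w (trans (sym (occ-≢ w a≢j)) e) j∈

  occ≡suc-split : ∀ {m k} w → occ m w ≡ suc k →
    Σ[ p ∈ List ℕ ] Σ[ s ∈ List ℕ ] (w ≡ p ++ m ∷ s × m ∉ p × occ m s ≡ k)
  occ≡suc-split {m} (a ∷ w) e with a ≟ m
  ... | yes refl = [] , w , refl , (λ ()) , ℕP.suc-injective (trans (sym (occ-≡ a w)) e)
  ... | no a≢m with occ≡suc-split w (trans (sym (occ-≢ w a≢m)) e)
  ...   | p , s , refl , m∉p , occ≡ =
          a ∷ p , s , refl , (λ { (here e′) → a≢m (sym e′) ; (there m∈) → m∉p m∈ }) , occ≡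

  takeUntil-first : ∀ {m} p s → m ∉ p → takeUntil m (p ++ m ∷ s) ≡ p
  takeUntil-first {m} [] s _ = takeUntil-≡ m s
  takeUntil-first (a ∷ p) s m∉ =
    trans (takeUntil-≢ (p ++ _ ∷ s) (λ e → m∉ (here (sym e)))) (cong (a ∷_) (takeUntil-first p s (λ m∈ → m∉ (there m∈))))

  dropUntil-first : ∀ {m} p s → m ∉ p → dropUntil m (p ++ m ∷ s) ≡ s
  dropUntil-first {m} [] s _ = dropUntil-≡ m s
  dropUntil-first (a ∷ p) s m∉ =
    trans (dropUntil-≢ (p ++ _ ∷ s) (λ e → m∉ (here (sym e)))) (dropUntil-first p s (λ m∈ → m∉ (there m∈)))

  twinInsertions : ℕ → List ℕ → List (List ℕ)
  twinInsertions m [] = (m ∷ m ∷ []) ∷ []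
  twinInsertions m (a ∷ w) = (m ∷ m ∷ a ∷ w) ∷ map (a ∷_) (twinInsertions m w)

  ∈-twinInsertions⁻ : ∀ m w {v} → v ∈ twinInsertions m w →
    Σ[ p ∈ List ℕ ] Σ[ s ∈ List ℕ ] (w ≡ p ++ s × v ≡ p ++ m ∷ m ∷ s)
  ∈-twinInsertions⁻ m [] (here refl) = [] , [] , refl , refl
  ∈-twinInsertions⁻ m (a ∷ w) (here refl) = [] , a ∷ w , refl , refl
  ∈-twinInsertions⁻ m (a ∷ w) (there v∈) with ∈-map⁻ (a ∷_) v∈
  ... | v′ , v′∈ , refl with ∈-twinInsertions⁻ m w v′∈
  ...   | p , s , refl , refl = a ∷ p , s , refl , refl

  ∈-twinInsertions⁺ : ∀ m p s → (p ++ m ∷ m ∷ s) ∈ twinInsertions m (p ++ s)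
  ∈-twinInsertions⁺ m [] [] = here refl
  ∈-twinInsertions⁺ m [] (a ∷ s) = here refl
  ∈-twinInsertions⁺ m (a ∷ p) s = there (∈-map⁺ (a ∷_) (∈-twinInsertions⁺ m p s))

  twinInsertions-unique : ∀ m w → m ∉ w → Unique (twinInsertions m w)
  twinInsertions-unique m [] _ = [] ∷ []
  twinInsertions-unique m (a ∷ w) m∉ =
    All.tabulate (λ v∈ e → let (_ , _ , e₂) = ∈-map⁻ (a ∷_) v∈ in m∉ (here (∷-injectiveˡ (trans e e₂))))
    ∷ Unique.map⁺ ∷-injectiveʳ (twinInsertions-unique m w (λ m∈ → m∉ (there m∈)))

  removeAll-twinInsertions : ∀ m w {v} → m ∉ w → v ∈ twinInsertions m w → removeAll m v ≡ w
  removeAll-twinInsertions m w m∉ v∈ with ∈-twinInsertions⁻ m w v∈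
  ... | p , s , refl , refl =
    trans (filterᵇ-++ _ p (m ∷ m ∷ s))
      (trans (cong (removeAll m p ++_) (trans (removeAll-≡ m (m ∷ s)) (removeAll-≡ m s)))
        (cong₂ _++_ (removeAll-∉ p (λ m∈ → m∉ (∈-++⁺ˡ m∈))) (removeAll-∉ s (λ m∈ → m∉ (∈-++⁺ʳ p m∈)))))

  length-twin : ∀ (p s : List ℕ) m → length (p ++ m ∷ m ∷ s) ≡ 2 + length (p ++ s)
  length-twin p s m =
    trans (length-++ p) (trans (ℕP.+-suc _ _) (cong suc (trans (ℕP.+-suc _ _) (cong suc (sym (length-++ p))))))

  suc∉Stirling : ∀ {n σ} → IsStirling n σ → suc n ∉ σ
  suc∉Stirling s n+1∈ = ℕP.<-irrefl refl (proj₂ (IsStirling.bounded s n+1∈))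

  IsStirling-twinInsertion : ∀ n {σ v} → IsStirling n σ → v ∈ twinInsertions (suc n) σ → IsStirling (suc n) v
  IsStirling-twinInsertion n {σ} st v∈ with ∈-twinInsertions⁻ (suc n) σ v∈
  ... | p , s , refl , refl = record
    { length≡ = trans (length-twin p s m) (trans (cong (2 +_) (IsStirling.length≡ st)) (sym (ℕP.*-suc 2 n)))
    ; bounded = bounded′
    ; twice = twice′
    ; nested = nested′
    }
    where
    m = suc n
    v = p ++ m ∷ m ∷ s
    m∉ : m ∉ p ++ s
    m∉ = suc∉Stirling st
    erase-m : removeAll m v ≡ p ++ s
    erase-m = removeAll-twinInsertions m (p ++ s) m∉ v∈
    bounded′ : ∀ {a} → a ∈ v → 0 < a × a < suc m
    bounded′ a∈ with ∈-++⁻ p a∈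
    ... | inj₁ a∈p = let (0<a , a<) = IsStirling.bounded st (∈-++⁺ˡ a∈p) in 0<a , ℕP.m<n⇒m<1+n a<
    ... | inj₂ (here refl) = z<s , ℕP.≤-refl
    ... | inj₂ (there (here refl)) = z<s , ℕP.≤-refl
    ... | inj₂ (there (there a∈s)) = let (0<a , a<) = IsStirling.bounded st (∈-++⁺ʳ p a∈s) in 0<a , ℕP.m<n⇒m<1+n a<
    twice′ : ∀ {j} → j ∈ range m → occ j v ≡ 2
    twice′ {j} j∈ with j ≟ m
    ... | yes refl = trans (countᵇ-++ _ p (m ∷ m ∷ s))
           (cong₂ _+_ (occ-∉ p (λ m∈ → m∉ (∈-++⁺ˡ m∈)))
              (trans (occ-≡ m (m ∷ s)) (cong suc (trans (occ-≡ m s) (cong suc (occ-∉ s (λ m∈ → m∉ (∈-++⁺ʳ p m∈))))))))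
    ... | no j≢m = trans (sym (occ-removeAll j≢m v))
                     (trans (cong (occ j) erase-m) (IsStirling.twice st (∈-range-pred j∈ j≢m)))
    nested′ : ∀ {j} → j ∈ range m → ∀ {a} → a ∈ between j v → j < a
    nested′ {j} j∈ {a} a∈ with j ≟ m
    ... | yes refl with () ← subst (a ∈_)
            (trans (cong (takeUntil m) (dropUntil-first p (m ∷ s) (λ m∈ → m∉ (∈-++⁺ˡ m∈)))) (takeUntil-≡ m s)) a∈
    nested′ {j} j∈ {a} a∈ | no j≢m with a ≟ m
    ... | yes refl = ℕP.≤∧≢⇒< (ℕP.≤-pred (proj₂ (∈-range⁻ j∈))) j≢m
    ... | no a≢m = IsStirling.nested st (∈-range-pred j∈ j≢m)
                     (subst (a ∈_) (trans (sym (between-removeAll j≢m v)) (cong (between j) erase-m))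
                       (∈-filterᵇ⁺ _ a∈ (T-not⁺ (λ t → a≢m (≡ᵇ⇒≡ t)))))

  -- Nothing can lie between the two copies of the largest letter.
  max-adjacent : ∀ n {v} → IsStirling (suc n) v →
    Σ[ p ∈ List ℕ ] Σ[ s ∈ List ℕ ] (v ≡ p ++ suc n ∷ suc n ∷ s × suc n ∉ p ++ s)
  max-adjacent n {v} st with occ≡suc-split v (IsStirling.twice st (max∈range n))
  ... | p , r , refl , m∉p , occ≡1 with occ≡suc-split r occ≡1
  ...   | q , s , refl , m∉q , occ≡0 = go q refl m∉q
    where
    m = suc n
    m∉s : m ∉ s
    m∉s = occ≡0⇒∉ s occ≡0
    go : ∀ q′ → q′ ≡ q → m ∉ q′ → Σ[ p ∈ List ℕ ] Σ[ s ∈ List ℕ ] (v ≡ p ++ m ∷ m ∷ s × m ∉ p ++ s)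
    go [] refl _ = p , s , refl , λ m∈ → [ m∉p , m∉s ]′ (∈-++⁻ p m∈)
    go (a ∷ _) refl _ with () ← ℕP.<⇒≱
      (IsStirling.nested st (max∈range n)
        (subst (a ∈_) (sym (trans (cong (takeUntil m) (dropUntil-first p (q ++ m ∷ s) m∉p)) (takeUntil-first q s m∉q)))
          (here refl)))
      (ℕP.≤-pred (proj₂ (IsStirling.bounded st (∈-++⁺ʳ p (there (here refl))))))

  IsStirling-removeTwin : ∀ n p s → IsStirling (suc n) (p ++ suc n ∷ suc n ∷ s) → suc n ∉ p ++ s →
    IsStirling n (p ++ s)
  IsStirling-removeTwin n p s st m∉ = record
    { length≡ = ℕP.suc-injective (ℕP.suc-injective
        (trans (sym (length-twin p s m)) (trans (IsStirling.length≡ st) (ℕP.*-suc 2 n))))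
    ; bounded = λ a∈ → let (0<a , a<) = IsStirling.bounded st (⊆v a∈) in
        0<a , ℕP.≤∧≢⇒< (ℕP.≤-pred a<) (λ e → m∉ (subst (_∈ p ++ s) e a∈))
    ; twice = λ {j} j∈ →
        trans (cong (occ j) (sym erase-m)) (trans (occ-removeAll (j≢m j∈) v) (IsStirling.twice st (∈-range-suc j∈)))
    ; nested = λ {j} j∈ {a} a∈ → IsStirling.nested st (∈-range-suc j∈)
        (proj₁ (∈-filterᵇ⁻ _ (between j v)
          (subst (a ∈_) (trans (cong (between j) (sym erase-m)) (between-removeAll (j≢m j∈) v)) a∈)))
    }
    where
    m = suc n
    v = p ++ m ∷ m ∷ s
    ⊆v : ∀ {a} → a ∈ p ++ s → a ∈ v
    ⊆v a∈ = [ ∈-++⁺ˡ , (λ a∈s → ∈-++⁺ʳ p (there (there a∈s))) ]′ (∈-++⁻ p a∈)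
    erase-m : removeAll m v ≡ p ++ s
    erase-m = removeAll-twinInsertions m (p ++ s) m∉ (∈-twinInsertions⁺ m p s)
    j≢m : ∀ {j} → j ∈ range n → j ≢ m
    j≢m j∈ e = ℕP.<-irrefl e (proj₂ (∈-range⁻ j∈))

  Q-suc↭ : ∀ n → Q (suc n) ↭ concatMap (twinInsertions (suc n)) (Q n)
  Q-suc↭ n = unique∧set⇒↭ (Q-unique (suc n))
    (concatMap-unique (twinInsertions (suc n)) (removeAll (suc n)) (Q-unique n)
       (λ {σ} σ∈ → twinInsertions-unique (suc n) σ (suc∉Stirling (∈-Q⁻ n σ∈)))
       (λ {σ} σ∈ → removeAll-twinInsertions (suc n) σ (suc∉Stirling (∈-Q⁻ n σ∈))))
    ⊆insertions
    (λ v∈ → let (σ , σ∈ , v∈σ) = ∈-concatMap⁻ (twinInsertions (suc n)) (Q n) v∈ in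
      ∈-Q⁺ (suc n) (IsStirling-twinInsertion n (∈-Q⁻ n σ∈) v∈σ))
    where
    ⊆insertions : ∀ {v} → v ∈ Q (suc n) → v ∈ concatMap (twinInsertions (suc n)) (Q n)
    ⊆insertions v∈ with ∈-Q⁻ (suc n) v∈
    ... | st with max-adjacent n st
    ...   | p , s , refl , m∉ =
            ∈-concatMap⁺ (twinInsertions (suc n)) (∈-Q⁺ n (IsStirling-removeTwin n p s st m∉)) (∈-twinInsertions⁺ (suc n) p s)

module TripleMonomials where

  open import Data.Nat as ℕ using (ℕ)
  open import Data.Product using (_×_; _,_)

  Triple : Set
  Triple = ℕ × ℕ × ℕ

  _+³_ : Triple → Triple → Triple
  (i , j , k) +³ (i′ , j′ , k′) = (i ℕ.+ i′ , j ℕ.+ j′ , k ℕ.+ k′)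

  module Monomial {c ℓ : Level} (R : CommutativeSemiring c ℓ) (u v w : CommutativeSemiring.Carrier R) where

    open CommutativeSemiring R
    open import Algebra.Definitions.RawSemiring rawSemiring using (_^_)
    open import Algebra.Properties.Semiring.Exp semiring using (^-homo-*)
    open import Algebra.Solver.Ring.NaturalCoefficients.Default R

    monomial : Triple → Carrier
    monomial (i , j , k) = u ^ i * v ^ j * w ^ k

    monomial-+³ : ∀ s t → monomial (s +³ t) ≈ monomial s * monomial t
    monomial-+³ (i , j , k) (i′ , j′ , k′) =
      trans (*-cong (*-cong (^-homo-* u i i′) (^-homo-* v j j′)) (^-homo-* w k k′))
        (solve 6 (λ a b c d e f → a :* b :* (c :* d) :* (e :* f) := a :* c :* e :* (b :* d :* f)) refl _ _ _ _ _ _)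

    monomial-0 : monomial (0 , 0 , 0) ≈ 1#
    monomial-0 = trans (*-identityʳ _) (*-identityʳ _)

module GapStatistics where

  open import Data.Nat as ℕ using (ℕ; _<_)
  open import Data.Nat.Properties as ℕP using ()
  open import Data.Bool using (Bool; T)
  open import Relation.Nullary using (¬_)
  open import Data.Product using (_×_; _,_; proj₁; proj₂)
  open import Data.List using (List; []; _∷_; [_]; _++_)
  open import Relation.Binary.PropositionalEquality using (_≡_; refl; sym; trans; cong; cong₂)
  open ListLemmas
  open TripleMonomials using (Triple; _+³_)

  isDescent isAscent isPlateau : ℕ × ℕ → Bool
  isDescent π = proj₂ π ℕ.<ᵇ proj₁ π
  isAscent π = proj₁ π ℕ.<ᵇ proj₂ π
  isPlateau π = proj₁ π ℕ.≡ᵇ proj₂ π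

  gaps : List ℕ → List (ℕ × ℕ)
  gaps σ = pairs (0 ∷ σ ++ [ 0 ])

  statistics : List ℕ → Triple
  statistics σ = (des σ , asc σ , plat σ)

  gapStatistics : List (ℕ × ℕ) → Triple
  gapStatistics L = (countᵇ isDescent L , countᵇ isAscent L , countᵇ isPlateau L)

  gapIndicators : ℕ × ℕ → Triple
  gapIndicators π = (indicator (isDescent π) , indicator (isAscent π) , indicator (isPlateau π))

  gapStatistics-∷ : ∀ π L → gapStatistics (π ∷ L) ≡ gapIndicators π +³ gapStatistics L
  gapStatistics-∷ π L =
    cong₂ _,_ (countᵇ-∷ isDescent π L) (cong₂ _,_ (countᵇ-∷ isAscent π L) (countᵇ-∷ isPlateau π L))

  lastOr : ℕ → List ℕ → ℕ
  lastOr a [] = a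
  lastOr _ (a ∷ w) = lastOr a w

  pairs-snoc : ∀ a w b → pairs (a ∷ w ++ [ b ]) ≡ pairs (a ∷ w) ++ [ (lastOr a w , b) ]
  pairs-snoc a [] b = refl
  pairs-snoc a (a′ ∷ w) b = cong ((a , a′) ∷_) (pairs-snoc a′ w b)

  -- Of the two pairs that `gaps` adds, (0, a) is neither a descent nor a plateau and (last, 0) is not an ascent.
  statistics≡gapStatistics : ∀ a σ → 0 < a → statistics (a ∷ σ) ≡ gapStatistics (gaps (a ∷ σ))
  statistics≡gapStatistics a σ 0<a = cong₂ _,_ des≡ (cong₂ _,_ asc≡ plat≡)
    where
    0≮ : ∀ {b} → ¬ T (b ℕ.<ᵇ 0)
    0≮ {b} t with () ← <ᵇ⇒< {b} {0} t
    des≡ : des (a ∷ σ) ≡ countᵇ isDescent (gaps (a ∷ σ))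
    des≡ = sym (countᵇ-∷-¬T isDescent (0 , a) (pairs (a ∷ σ ++ [ 0 ])) (0≮ {a}))
    plat≡ : plat (a ∷ σ) ≡ countᵇ isPlateau (gaps (a ∷ σ))
    plat≡ = sym (countᵇ-∷-¬T isPlateau (0 , a) (pairs (a ∷ σ ++ [ 0 ])) (λ t → ℕP.<⇒≢ 0<a (≡ᵇ⇒≡ t)))
    asc≡ : asc (a ∷ σ) ≡ countᵇ isAscent (gaps (a ∷ σ))
    asc≡ = sym (trans (cong (countᵇ isAscent) (pairs-snoc 0 (a ∷ σ) 0))
             (trans (countᵇ-++ isAscent (pairs (0 ∷ a ∷ σ)) _)
               (trans (cong (countᵇ isAscent (pairs (0 ∷ a ∷ σ)) ℕ.+_) (countᵇ-∷-¬T isAscent (lastOr a σ , 0) [] (0≮ {lastOr a σ})))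
                 (ℕP.+-identityʳ _))))

module StirlingWeights {c ℓ : Level} (R : CommutativeSemiring c ℓ) (x y z : CommutativeSemiring.Carrier R) where

  open import Data.Nat as ℕ using (ℕ; suc; _<_; _≤_; z≤n)
  open import Data.Nat.Properties as ℕP using ()
  open import Data.Bool using (if_then_else_)
  open import Data.Product using (_×_; _,_; proj₁)
  open import Data.List using (List; []; _∷_; [_]; _++_)
  open import Data.List.Membership.Propositional using (_∈_)
  open import Data.List.Relation.Unary.Any using (here; there)
  open import Relation.Binary.Definitions using (tri<; tri≈; tri>)
  import Relation.Binary.PropositionalEquality as P
  open CommutativeSemiring R
  open import Algebra.Solver.Ring.NaturalCoefficients.Default R
  open ListLemmas
  open TripleMonomials
  open Monomial R x y z
  open GapStatistics
  open StirlingPermutations using (IsStirling; twinInsertions)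
  open Sums R

  weight : ℕ × ℕ → Carrier
  weight π = if isDescent π then x else if isAscent π then y else z

  ∏weight : List (ℕ × ℕ) → Carrier
  ∏weight [] = 1#
  ∏weight (π ∷ L) = weight π * ∏weight L

  -- ∑ over the positions of the product of the other weights; as every weight is a variable,
  -- this is (∂ₓ + ∂_y + ∂_z) ∏weight.
  ∂∏weight : List (ℕ × ℕ) → Carrier
  ∂∏weight [] = 0#
  ∂∏weight (π ∷ L) = ∏weight L + weight π * ∂∏weight L

  weight-ascent : ∀ {a b} → a < b → weight (a , b) ≈ y
  weight-ascent a<b = reflexive (P.trans (if-¬T (λ t → ℕP.<-asym a<b (<ᵇ⇒< t))) (if-T (<⇒<ᵇ a<b)))

  weight-plateau : ∀ a → weight (a , a) ≈ z
  weight-plateau a = reflexive (P.trans (if-¬T a≮a) (if-¬T a≮a))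
    where a≮a = λ t → ℕP.<-irrefl P.refl (<ᵇ⇒< {a} {a} t)

  weight-descent : ∀ {a b} → b < a → weight (a , b) ≈ x
  weight-descent b<a = reflexive (if-T (<⇒<ᵇ b<a))

  monomial-gapIndicators : ∀ π → monomial (gapIndicators π) ≈ weight π
  monomial-gapIndicators (a , b) with ℕP.<-cmp a b
  ... | tri< a<b a≢b _ =
    trans (reflexive (P.cong monomial (P.cong₂ _,_ (if-¬T (λ t → ℕP.<-asym a<b (<ᵇ⇒< t)))
                                        (P.cong₂ _,_ (if-T (<⇒<ᵇ a<b)) (if-¬T (λ t → a≢b (≡ᵇ⇒≡ t)))))))
      (trans (solve 3 (λ x y z → con 1 :* (y :* con 1) :* con 1 := y) refl x y z) (sym (weight-ascent a<b)))
  ... | tri≈ _ P.refl _ =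
    trans (reflexive (P.cong monomial (P.cong₂ _,_ (if-¬T a≮a) (P.cong₂ _,_ (if-¬T a≮a) (if-T (≡⇒≡ᵇ {a} P.refl))))))
      (trans (solve 3 (λ x y z → con 1 :* con 1 :* (z :* con 1) := z) refl x y z) (sym (weight-plateau a)))
    where a≮a = λ t → ℕP.<-irrefl P.refl (<ᵇ⇒< {a} {a} t)
  ... | tri> _ a≢b b<a =
    trans (reflexive (P.cong monomial (P.cong₂ _,_ (if-T (<⇒<ᵇ b<a))
                                        (P.cong₂ _,_ (if-¬T (λ t → ℕP.<-asym b<a (<ᵇ⇒< t))) (if-¬T (λ t → a≢b (≡ᵇ⇒≡ t)))))))
      (trans (solve 3 (λ x y z → x :* con 1 :* con 1 :* con 1 := x) refl x y z) (sym (weight-descent b<a)))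

  monomial-gapStatistics : ∀ L → monomial (gapStatistics L) ≈ ∏weight L
  monomial-gapStatistics [] = monomial-0
  monomial-gapStatistics (π ∷ L) =
    trans (reflexive (P.cong monomial (gapStatistics-∷ π L)))
      (trans (monomial-+³ (gapIndicators π) (gapStatistics L)) (*-cong (monomial-gapIndicators π) (monomial-gapStatistics L)))

  monomial-statistics : ∀ {k v} → IsStirling k v → 1 ≤ k → monomial (statistics v) ≈ ∏weight (gaps v)
  monomial-statistics {suc k} {[]} st _ with () ← IsStirling.length≡ st
  monomial-statistics {v = a ∷ σ} st _ =
    trans (reflexive (P.cong monomial (statistics≡gapStatistics a σ (proj₁ (IsStirling.bounded st (here P.refl))))))
      (monomial-gapStatistics (gaps (a ∷ σ)))

  -- Inserting m m into the gap (a, b) replaces its weight by weight (a , m) * weight (m , m) * weight (m , b) = y z x.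
  ∑-twinInsertions : ∀ m a w → a < m → (∀ {b} → b ∈ w → b < m) →
    ∑ (twinInsertions m w) (λ v → ∏weight (pairs (a ∷ v ++ [ 0 ]))) ≈ x * y * z * ∂∏weight (pairs (a ∷ w ++ [ 0 ]))
  ∑-twinInsertions m a [] a<m _ =
    trans (+-identityʳ _)
      (trans (*-cong (weight-ascent a<m) (*-cong (weight-plateau m) (*-cong (weight-descent (ℕP.≤-<-trans z≤n a<m)) refl)))
        (solve 4 (λ x y z w → y :* (z :* (x :* con 1)) := x :* y :* z :* (con 1 :+ w :* con 0)) refl x y z (weight (a , 0))))
  ∑-twinInsertions m a (b ∷ w) a<m w<m =
    trans (+-congˡ (trans (∑-map (twinInsertions m w) (b ∷_) _)
      (trans (sym (*-distribˡ-∑ (twinInsertions m w) (weight (a , b)) (λ v → ∏weight (pairs (b ∷ v ++ [ 0 ])))))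
        (*-congˡ (∑-twinInsertions m b w (w<m (here P.refl)) (λ b∈ → w<m (there b∈)))))))
      (trans (+-congʳ (*-cong (weight-ascent a<m) (*-cong (weight-plateau m) (*-congʳ (weight-descent (w<m (here P.refl)))))))
        (solve 6 (λ x y z p u d → y :* (z :* (x :* p)) :+ u :* (x :* y :* z :* d) := x :* y :* z :* (p :+ u :* d)) refl
          x y z (∏weight (pairs (b ∷ w ++ [ 0 ]))) (weight (a , b)) (∂∏weight (pairs (b ∷ w ++ [ 0 ])))))

module StirlingRecurrence {c ℓ : Level} (R : CommutativeSemiring c ℓ) (x y z : CommutativeSemiring.Carrier R) where

  open import Data.Nat as ℕ using (suc; _≤_; z≤n; s≤s)
  open import Data.Bool using (true; false; if_then_else_)
  open import Data.Product using (_×_; _,_; proj₁; proj₂)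
  open import Data.List using ([]; _∷_; concatMap)
  import Relation.Binary.PropositionalEquality as P
  open CommutativeSemiring R
  open import Algebra.Solver.Ring.NaturalCoefficients.Default R
  open import Relation.Binary.Reasoning.Setoid setoid
  open StirlingPermutations using (Q-suc↭; twinInsertions; ∈-Q⁻; IsStirling-twinInsertion; module IsStirling)
  open GapStatistics using (isDescent; isAscent; gaps; statistics)
  open DualNumbers R using (Dual; _+ε; ε-part-sum)
  open Sums R
  module W = StirlingWeights R x y z
  module Wε = StirlingWeights Dual (x +ε) (y +ε) (z +ε)
  open TripleMonomials using (module Monomial)
  open Monomial R x y z using (monomial)
  open Monomial Dual (x +ε) (y +ε) (z +ε) using () renaming (monomial to monomialε)

  weight-ε : ∀ π → (proj₁ (Wε.weight π) P.≡ W.weight π) × (proj₂ (Wε.weight π) P.≡ 1#)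
  weight-ε π = by-cases (isDescent π) (isAscent π)
    where
    by-cases : ∀ d a → (proj₁ (if d then x +ε else if a then y +ε else z +ε) P.≡ (if d then x else if a then y else z))
                       × (proj₂ (if d then x +ε else if a then y +ε else z +ε) P.≡ 1#)
    by-cases true _ = P.refl , P.refl
    by-cases false true = P.refl , P.refl
    by-cases false false = P.refl , P.refl

  ∏weight-ε : ∀ L → (proj₁ (Wε.∏weight L) ≈ W.∏weight L) × (proj₂ (Wε.∏weight L) ≈ W.∂∏weight L)
  ∏weight-ε [] = refl , refl
  ∏weight-ε (π ∷ L) =
    let (w₁ , w₂) = weight-ε π ; (p₁ , p₂) = ∏weight-ε L in
    *-cong (reflexive w₁) p₁ ,
    trans (+-cong (*-cong (reflexive w₁) p₂) (*-cong (reflexive w₂) p₁))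
      (solve 3 (λ w d p → w :* d :+ con 1 :* p := p :+ w :* d) refl (W.weight π) (W.∂∏weight L) (W.∏weight L))

  C-suc : ∀ n → 1 ≤ n → Poly.C R (suc n) x y z ≈ x * y * z * proj₂ (Poly.C Dual n (x +ε) (y +ε) (z +ε))
  C-suc n 1≤n = begin
    ∑ (Q (suc n)) (λ v → monomial (statistics v))
      ≈⟨ ∑-↭ _ (Q-suc↭ n) ⟩
    ∑ (concatMap (twinInsertions (suc n)) (Q n)) (λ v → monomial (statistics v))
      ≈⟨ ∑-concatMap (Q n) (twinInsertions (suc n)) _ ⟩
    ∑ (Q n) (λ σ → ∑ (twinInsertions (suc n) σ) (λ v → monomial (statistics v)))
      ≈⟨ ∑-cong (Q n) (λ {σ} σ∈ → let st = ∈-Q⁻ n σ∈ in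
           trans (∑-cong (twinInsertions (suc n) σ) (λ v∈ → W.monomial-statistics (IsStirling-twinInsertion n st v∈) (s≤s z≤n)))
                 (W.∑-twinInsertions (suc n) 0 σ (s≤s z≤n) (λ a∈ → proj₂ (IsStirling.bounded st a∈)))) ⟩
    ∑ (Q n) (λ σ → x * y * z * W.∂∏weight (gaps σ))
      ≈⟨ sym (*-distribˡ-∑ (Q n) (x * y * z) (λ σ → W.∂∏weight (gaps σ))) ⟩
    x * y * z * ∑ (Q n) (λ σ → W.∂∏weight (gaps σ))
      ≈⟨ *-congˡ (sym (∑-cong (Q n) (λ {σ} σ∈ →
           trans (proj₂ (Wε.monomial-statistics (∈-Q⁻ n σ∈) 1≤n)) (proj₂ (∏weight-ε (gaps σ)))))) ⟩
    x * y * z * ∑ (Q n) (λ σ → proj₂ (monomialε (statistics σ)))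
      ≈⟨ *-congˡ (reflexive (P.sym (ε-part-sum (Q n) (λ σ → monomialε (statistics σ))))) ⟩
    x * y * z * proj₂ (Poly.C Dual n (x +ε) (y +ε) (z +ε)) ∎

module TreeGrowth where

  open import Data.Nat as ℕ using (ℕ; suc; _+_; _<_; _≤_; s≤s; _≟_)
  open import Data.Nat.Properties as ℕP using ()
  open import Data.Bool using (if_then_else_; T; T?)
  open import Data.Unit using (tt)
  open import Data.Product using (Σ-syntax; _×_; _,_; proj₁; proj₂)
  open import Data.Sum using (_⊎_; inj₁; inj₂)
  open import Data.List using (List; []; _∷_; map; _++_; length)
  open import Data.List.Properties using (length-++; ++-assoc; ∷-injectiveˡ; ∷-injectiveʳ)
  open import Data.List.Membership.Propositional using (_∈_; _∉_)
  open import Data.List.Membership.Propositional.Properties using (∈-map⁺; ∈-map⁻; ∈-++⁺ˡ; ∈-++⁺ʳ; ∈-++⁻)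
  open import Data.List.Relation.Unary.Any using (here; there)
  open import Data.List.Relation.Unary.All as All using (All; []; _∷_)
  import Data.List.Relation.Unary.All.Properties as All
  open import Data.List.Relation.Unary.Unique.Propositional using (Unique)
  open import Data.List.Relation.Unary.AllPairs using ([]; _∷_)
  import Data.List.Relation.Unary.Unique.Propositional.Properties as Unique
  open import Relation.Binary.PropositionalEquality using (_≡_; _≢_; refl; sym; trans; cong; cong₂; subst)
  open import Relation.Nullary using (yes; no)
  open ListLemmas
  open StirlingPermutations using (occ-≢; occ≡0⇒∉)

  node-injectiveʳ : ∀ {l} {u v : List Tree} → node l u ≡ node l v → u ≡ v
  node-injectiveʳ refl = refl

  children : Tree → List Tree
  children (node _ cs) = cs

  size : Tree → ℕ
  size t = length (labels t)

  root∈labels : ∀ t → root t ∈ labels t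
  root∈labels (node _ _) = here refl

  ∈-labelsF : ∀ {c cs a} → c ∈ cs → a ∈ labels c → a ∈ labelsF cs
  ∈-labelsF {cs = c ∷ _} (here refl) a∈ = ∈-++⁺ˡ a∈
  ∈-labelsF {cs = c ∷ _} (there c∈) a∈ = ∈-++⁺ʳ (labels c) (∈-labelsF c∈ a∈)

  labelsF-++ : ∀ as bs → labelsF (as ++ bs) ≡ labelsF as ++ labelsF bs
  labelsF-++ [] bs = refl
  labelsF-++ (t ∷ as) bs = trans (cong (labels t ++_) (labelsF-++ as bs)) (sym (++-assoc (labels t) (labelsF as) (labelsF bs)))

  AtMost3 : Tree → Set
  AtMost3 t = T (atMost3 t)

  atMost3F⁻ : ∀ cs → T (atMost3F cs) → All AtMost3 cs
  atMost3F⁻ [] _ = []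
  atMost3F⁻ (c ∷ cs) h = T-∧⁻ˡ h ∷ atMost3F⁻ cs (T-∧⁻ʳ {atMost3 c} h)

  atMost3F⁺ : ∀ {cs} → All AtMost3 cs → T (atMost3F cs)
  atMost3F⁺ [] = tt
  atMost3F⁺ (p ∷ ps) = T-∧⁺ p (atMost3F⁺ ps)

  IncreasingBelow : ℕ → Tree → Set
  IncreasingBelow l c = T (l ℕ.<ᵇ root c) × T (isIncreasing c)

  incrF⁻ : ∀ l cs → T (incrF l cs) → All (IncreasingBelow l) cs
  incrF⁻ l [] _ = []
  incrF⁻ l (c ∷ cs) h =
    (T-∧⁻ˡ h , T-∧⁻ˡ (T-∧⁻ʳ {l ℕ.<ᵇ root c} h)) ∷ incrF⁻ l cs (T-∧⁻ʳ {isIncreasing c} (T-∧⁻ʳ {l ℕ.<ᵇ root c} h))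

  incrF⁺ : ∀ {l cs} → All (IncreasingBelow l) cs → T (incrF l cs)
  incrF⁺ [] = tt
  incrF⁺ ((p , q) ∷ ps) = T-∧⁺ p (T-∧⁺ q (incrF⁺ ps))

  All-insert : ∀ {P : Tree → Set} pre post u → All P (pre ++ post) → P u → All P (pre ++ u ∷ post)
  All-insert pre post u all pu = let (all₁ , all₂) = All.++⁻ pre all in All.++⁺ all₁ (pu ∷ all₂)

  attachHere : ℕ → ℕ → List Tree → List Tree
  attachHere m l cs = if length cs ℕ.<ᵇ 3 then map (node l) (insertions (node m []) cs) else []

  mutual
    addLeaf : ℕ → Tree → List Tree
    addLeaf m (node l cs) = attachHere m l cs ++ map (node l) (addLeafF m cs)

    addLeafF : ℕ → List Tree → List (List Tree)
    addLeafF m [] = []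
    addLeafF m (t ∷ ts) = map (_∷ ts) (addLeaf m t) ++ map (t ∷_) (addLeafF m ts)

  ∈-attachHere⁻ : ∀ m l cs {t} → t ∈ attachHere m l cs →
    T (length cs ℕ.<ᵇ 3) × Σ[ cs′ ∈ List Tree ] (cs′ ∈ insertions (node m []) cs × t ≡ node l cs′)
  ∈-attachHere⁻ m l cs {t} t∈ with T? (length cs ℕ.<ᵇ 3)
  ... | yes room = room , ∈-map⁻ (node l) (subst (t ∈_) (if-T room) t∈)
  ... | no full with () ← subst (t ∈_) (if-¬T full) t∈

  ∈-attachHere⁺ : ∀ m l cs {cs′} → T (length cs ℕ.<ᵇ 3) → cs′ ∈ insertions (node m []) cs → node l cs′ ∈ attachHere m l cs
  ∈-attachHere⁺ m l cs room cs′∈ = subst (node l _ ∈_) (sym (if-T room)) (∈-map⁺ (node l) cs′∈)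

  length-children-attachHere : ∀ m l cs {t} → t ∈ attachHere m l cs → length (children t) ≡ suc (length cs)
  length-children-attachHere m l cs t∈ with ∈-attachHere⁻ m l cs t∈
  ... | _ , cs′ , cs′∈ , refl = length-insertions (node m []) cs cs′∈

  attachHere-unique : ∀ m l cs → node m [] ∉ cs → Unique (attachHere m l cs)
  attachHere-unique m l cs leaf∉ with T? (length cs ℕ.<ᵇ 3)
  ... | yes room = subst Unique (sym (if-T room)) (Unique.map⁺ node-injectiveʳ (insertions-unique (node m []) cs leaf∉))
  ... | no full = subst Unique (sym (if-¬T full)) []

  ∈-addLeaf⁻ : ∀ m l cs {t} → t ∈ addLeaf m (node l cs) →
    (T (length cs ℕ.<ᵇ 3) × Σ[ cs′ ∈ List Tree ] (cs′ ∈ insertions (node m []) cs × t ≡ node l cs′))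
    ⊎ Σ[ cs′ ∈ List Tree ] (cs′ ∈ addLeafF m cs × t ≡ node l cs′)
  ∈-addLeaf⁻ m l cs t∈ with ∈-++⁻ (attachHere m l cs) t∈
  ... | inj₁ t∈here = inj₁ (∈-attachHere⁻ m l cs t∈here)
  ... | inj₂ t∈below = inj₂ (∈-map⁻ (node l) t∈below)

  ∈-addLeaf⁺-here : ∀ m l cs {cs′} → T (length cs ℕ.<ᵇ 3) → cs′ ∈ insertions (node m []) cs → node l cs′ ∈ addLeaf m (node l cs)
  ∈-addLeaf⁺-here m l cs room cs′∈ = ∈-++⁺ˡ (∈-attachHere⁺ m l cs room cs′∈)

  ∈-addLeaf⁺-below : ∀ m l cs {cs′} → cs′ ∈ addLeafF m cs → node l cs′ ∈ addLeaf m (node l cs)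
  ∈-addLeaf⁺-below m l cs cs′∈ = ∈-++⁺ʳ (attachHere m l cs) (∈-map⁺ (node l) cs′∈)

  ∈-addLeafF⁻ : ∀ m c ts {cs′} → cs′ ∈ addLeafF m (c ∷ ts) →
    Σ[ c′ ∈ Tree ] (c′ ∈ addLeaf m c × cs′ ≡ c′ ∷ ts) ⊎ Σ[ ts′ ∈ List Tree ] (ts′ ∈ addLeafF m ts × cs′ ≡ c ∷ ts′)
  ∈-addLeafF⁻ m c ts cs′∈ with ∈-++⁻ (map (_∷ ts) (addLeaf m c)) cs′∈
  ... | inj₁ ∈head = inj₁ (∈-map⁻ (_∷ ts) ∈head)
  ... | inj₂ ∈tail = inj₂ (∈-map⁻ (c ∷_) ∈tail)

  ∈-addLeafF⁺-head : ∀ m c ts {c′} → c′ ∈ addLeaf m c → (c′ ∷ ts) ∈ addLeafF m (c ∷ ts)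
  ∈-addLeafF⁺-head m c ts c′∈ = ∈-++⁺ˡ (∈-map⁺ (_∷ ts) c′∈)

  ∈-addLeafF⁺-tail : ∀ m c ts {ts′} → ts′ ∈ addLeafF m ts → (c ∷ ts′) ∈ addLeafF m (c ∷ ts)
  ∈-addLeafF⁺-tail m c ts ts′∈ = ∈-++⁺ʳ (map (_∷ ts) (addLeaf m c)) (∈-map⁺ (c ∷_) ts′∈)

  root-addLeaf : ∀ m t₀ {t} → t ∈ addLeaf m t₀ → root t ≡ root t₀
  root-addLeaf m (node l cs) t∈ with ∈-addLeaf⁻ m l cs t∈
  ... | inj₁ (_ , _ , _ , refl) = refl
  ... | inj₂ (_ , _ , refl) = refl

  length-addLeafF : ∀ m cs {cs′} → cs′ ∈ addLeafF m cs → length cs′ ≡ length cs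
  length-addLeafF m (c ∷ ts) cs′∈ with ∈-addLeafF⁻ m c ts cs′∈
  ... | inj₁ (_ , _ , refl) = refl
  ... | inj₂ (_ , ts′∈ , refl) = cong suc (length-addLeafF m ts ts′∈)

  InsertedInto : ℕ → List ℕ → List ℕ → Set
  InsertedInto m u v = Σ[ p ∈ List ℕ ] Σ[ s ∈ List ℕ ] (u ≡ p ++ s × v ≡ p ++ m ∷ s)

  mutual
    labels-addLeaf : ∀ m t₀ {t} → t ∈ addLeaf m t₀ → InsertedInto m (labels t₀) (labels t)
    labels-addLeaf m (node l cs) t∈ with ∈-addLeaf⁻ m l cs t∈
    ... | inj₁ (_ , _ , cs′∈ , refl) with ∈-insertions⁻ (node m []) cs cs′∈
    ...   | pre , post , refl , refl = l ∷ labelsF pre , labelsF post ,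
              cong (l ∷_) (labelsF-++ pre post) , cong (l ∷_) (labelsF-++ pre (node m [] ∷ post))
    labels-addLeaf m (node l cs) t∈ | inj₂ (_ , cs′∈ , refl) with labelsF-addLeafF m cs cs′∈
    ...   | p , s , e₁ , e₂ = l ∷ p , s , cong (l ∷_) e₁ , cong (l ∷_) e₂

    labelsF-addLeafF : ∀ m cs {cs′} → cs′ ∈ addLeafF m cs → InsertedInto m (labelsF cs) (labelsF cs′)
    labelsF-addLeafF m (c ∷ ts) cs′∈ with ∈-addLeafF⁻ m c ts cs′∈
    ... | inj₁ (_ , c′∈ , refl) with labels-addLeaf m c c′∈
    ...   | p , s , e₁ , e₂ = p , s ++ labelsF ts ,
              trans (cong (_++ labelsF ts) e₁) (++-assoc p s _) ,
              trans (cong (_++ labelsF ts) e₂) (++-assoc p (m ∷ s) _)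
    labelsF-addLeafF m (c ∷ ts) cs′∈ | inj₂ (_ , ts′∈ , refl) with labelsF-addLeafF m ts ts′∈
    ...   | p , s , e₁ , e₂ = labels c ++ p , s ,
              trans (cong (labels c ++_) e₁) (sym (++-assoc (labels c) p s)) ,
              trans (cong (labels c ++_) e₂) (sym (++-assoc (labels c) p (m ∷ s)))

  size-addLeaf : ∀ m t₀ {t} → t ∈ addLeaf m t₀ → size t ≡ suc (size t₀)
  size-addLeaf m t₀ t∈ with labels-addLeaf m t₀ t∈
  ... | p , s , e₁ , e₂ = trans (cong length e₂) (trans (length-++ p) (trans (ℕP.+-suc _ _)
                            (cong suc (trans (sym (length-++ p)) (cong length (sym e₁))))))

  mutual
    addLeaf-increasing : ∀ m t₀ {t} → t ∈ addLeaf m t₀ → T (isIncreasing t₀) → (∀ {a} → a ∈ labels t₀ → a < m) →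
      T (isIncreasing t)
    addLeaf-increasing m (node l cs) t∈ incr <m with ∈-addLeaf⁻ m l cs t∈
    ... | inj₁ (_ , _ , cs′∈ , refl) with ∈-insertions⁻ (node m []) cs cs′∈
    ...   | pre , post , refl , refl = incrF⁺ (All-insert pre post (node m []) (incrF⁻ l (pre ++ post) incr) (<⇒<ᵇ (<m (here refl)) , tt))
    addLeaf-increasing m (node l cs) t∈ incr <m | inj₂ (_ , cs′∈ , refl) =
      incrF⁺ (addLeafF-increasing m l cs cs′∈ (incrF⁻ l cs incr) (λ a∈ → <m (there a∈)))

    addLeafF-increasing : ∀ m l cs {cs′} → cs′ ∈ addLeafF m cs → All (IncreasingBelow l) cs →
      (∀ {a} → a ∈ labelsF cs → a < m) → All (IncreasingBelow l) cs′
    addLeafF-increasing m l (c ∷ ts) cs′∈ ((l<c , incr) ∷ incrs) <m with ∈-addLeafF⁻ m c ts cs′∈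
    ... | inj₁ (_ , c′∈ , refl) =
          (subst (λ r → T (l ℕ.<ᵇ r)) (sym (root-addLeaf m c c′∈)) l<c , addLeaf-increasing m c c′∈ incr (λ a∈ → <m (∈-++⁺ˡ a∈))) ∷ incrs
    ... | inj₂ (_ , ts′∈ , refl) = (l<c , incr) ∷ addLeafF-increasing m l ts ts′∈ incrs (λ a∈ → <m (∈-++⁺ʳ (labels c) a∈))

  mutual
    addLeaf-atMost3 : ∀ m t₀ {t} → t ∈ addLeaf m t₀ → AtMost3 t₀ → AtMost3 t
    addLeaf-atMost3 m (node l cs) t∈ at3 with ∈-addLeaf⁻ m l cs t∈
    ... | inj₁ (room , _ , cs′∈ , refl) with ∈-insertions⁻ (node m []) cs cs′∈
    ...   | pre , post , refl , refl =
             T-∧⁺ (<⇒<ᵇ (subst (ℕ._< 4) (sym (length-insertions (node m []) (pre ++ post) cs′∈)) (s≤s (<ᵇ⇒< room))))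
                  (atMost3F⁺ (All-insert pre post (node m []) (atMost3F⁻ (pre ++ post) (T-∧⁻ʳ {length (pre ++ post) ℕ.<ᵇ 4} at3)) tt))
    addLeaf-atMost3 m (node l cs) t∈ at3 | inj₂ (_ , cs′∈ , refl) =
      T-∧⁺ (subst (λ k → T (k ℕ.<ᵇ 4)) (sym (length-addLeafF m cs cs′∈)) (T-∧⁻ˡ at3))
           (atMost3F⁺ (addLeafF-atMost3 m cs cs′∈ (atMost3F⁻ cs (T-∧⁻ʳ {length cs ℕ.<ᵇ 4} at3))))

    addLeafF-atMost3 : ∀ m cs {cs′} → cs′ ∈ addLeafF m cs → All AtMost3 cs → All AtMost3 cs′
    addLeafF-atMost3 m (c ∷ ts) cs′∈ (at3 ∷ at3s) with ∈-addLeafF⁻ m c ts cs′∈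
    ... | inj₁ (_ , c′∈ , refl) = addLeaf-atMost3 m c c′∈ at3 ∷ at3s
    ... | inj₂ (_ , ts′∈ , refl) = at3 ∷ addLeafF-atMost3 m ts ts′∈ at3s

  -- Removes every child rooted at m; on the trees of interest this is the leaf m.
  mutual
    prune : ℕ → Tree → Tree
    prune m (node l cs) = node l (pruneF m cs)

    pruneF : ℕ → List Tree → List Tree
    pruneF m [] = []
    pruneF m (t ∷ ts) = if root t ℕ.≡ᵇ m then pruneF m ts else prune m t ∷ pruneF m ts

  pruneF-≡ : ∀ m t ts → root t ≡ m → pruneF m (t ∷ ts) ≡ pruneF m ts
  pruneF-≡ m t ts e = if-T (≡⇒≡ᵇ e)

  pruneF-≢ : ∀ m t ts → root t ≢ m → pruneF m (t ∷ ts) ≡ prune m t ∷ pruneF m ts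
  pruneF-≢ m t ts e = if-¬T (λ h → e (≡ᵇ⇒≡ h))

  pruneF-++ : ∀ m as bs → pruneF m (as ++ bs) ≡ pruneF m as ++ pruneF m bs
  pruneF-++ m [] bs = refl
  pruneF-++ m (t ∷ as) bs with root t ≟ m
  ... | yes e = trans (pruneF-≡ m t (as ++ bs) e) (trans (pruneF-++ m as bs) (cong (_++ pruneF m bs) (sym (pruneF-≡ m t as e))))
  ... | no e = trans (pruneF-≢ m t (as ++ bs) e)
                 (trans (cong (prune m t ∷_) (pruneF-++ m as bs)) (cong (_++ pruneF m bs) (sym (pruneF-≢ m t as e))))

  mutual
    prune-∉ : ∀ m t → m ∉ labels t → prune m t ≡ t
    prune-∉ m (node l cs) m∉ = cong (node l) (pruneF-∉ m cs (λ m∈ → m∉ (there m∈)))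

    pruneF-∉ : ∀ m cs → m ∉ labelsF cs → pruneF m cs ≡ cs
    pruneF-∉ m [] _ = refl
    pruneF-∉ m (t ∷ ts) m∉ =
      trans (pruneF-≢ m t ts (λ e → m∉ (∈-++⁺ˡ (subst (_∈ labels t) e (root∈labels t)))))
        (cong₂ _∷_ (prune-∉ m t (λ m∈ → m∉ (∈-++⁺ˡ m∈))) (pruneF-∉ m ts (λ m∈ → m∉ (∈-++⁺ʳ (labels t) m∈))))

  mutual
    prune-addLeaf : ∀ m t₀ {t} → m ∉ labels t₀ → t ∈ addLeaf m t₀ → prune m t ≡ t₀
    prune-addLeaf m (node l cs) m∉ t∈ with ∈-addLeaf⁻ m l cs t∈
    ... | inj₁ (_ , _ , cs′∈ , refl) with ∈-insertions⁻ (node m []) cs cs′∈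
    ...   | pre , post , refl , refl =
            cong (node l) (trans (pruneF-++ m pre (node m [] ∷ post))
              (trans (cong (pruneF m pre ++_) (pruneF-≡ m (node m []) post refl))
                (trans (sym (pruneF-++ m pre post)) (pruneF-∉ m (pre ++ post) (λ m∈ → m∉ (there m∈))))))
    prune-addLeaf m (node l cs) m∉ t∈ | inj₂ (_ , cs′∈ , refl) = cong (node l) (pruneF-addLeafF m cs (λ m∈ → m∉ (there m∈)) cs′∈)

    pruneF-addLeafF : ∀ m cs {cs′} → m ∉ labelsF cs → cs′ ∈ addLeafF m cs → pruneF m cs′ ≡ cs
    pruneF-addLeafF m (c ∷ ts) m∉ cs′∈ with ∈-addLeafF⁻ m c ts cs′∈
    ... | inj₁ (c′ , c′∈ , refl) =
          trans (pruneF-≢ m c′ ts (λ e → m∉ (∈-++⁺ˡ (subst (_∈ labels c) (trans (sym (root-addLeaf m c c′∈)) e) (root∈labels c)))))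
            (cong₂ _∷_ (prune-addLeaf m c (λ m∈ → m∉ (∈-++⁺ˡ m∈)) c′∈) (pruneF-∉ m ts (λ m∈ → m∉ (∈-++⁺ʳ (labels c) m∈))))
    ... | inj₂ (ts′ , ts′∈ , refl) =
          trans (pruneF-≢ m c ts′ (λ e → m∉ (∈-++⁺ˡ (subst (_∈ labels c) e (root∈labels c)))))
            (cong₂ _∷_ (prune-∉ m c (λ m∈ → m∉ (∈-++⁺ˡ m∈))) (pruneF-addLeafF m ts (λ m∈ → m∉ (∈-++⁺ʳ (labels c) m∈)) ts′∈))

  mutual
    addLeaf-unique : ∀ m t₀ → m ∉ labels t₀ → Unique (addLeaf m t₀)
    addLeaf-unique m (node l cs) m∉ =
      Unique.++⁺ (attachHere-unique m l cs (λ leaf∈ → m∉ (there (∈-labelsF leaf∈ (here refl)))))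
        (Unique.map⁺ node-injectiveʳ (addLeafF-unique m cs (λ m∈ → m∉ (there m∈))))
        λ (t∈here , t∈below) → let (cs′ , cs′∈ , e) = ∈-map⁻ (node l) t∈below in
          ℕP.1+n≢n (trans (sym (length-children-attachHere m l cs t∈here))
            (trans (cong (λ t → length (children t)) e) (length-addLeafF m cs cs′∈)))

    addLeafF-unique : ∀ m cs → m ∉ labelsF cs → Unique (addLeafF m cs)
    addLeafF-unique m [] _ = []
    addLeafF-unique m (c ∷ ts) m∉ =
      Unique.++⁺ (Unique.map⁺ ∷-injectiveˡ (addLeaf-unique m c (λ m∈ → m∉ (∈-++⁺ˡ m∈))))
        (Unique.map⁺ ∷-injectiveʳ (addLeafF-unique m ts (λ m∈ → m∉ (∈-++⁺ʳ (labels c) m∈))))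
        λ (∈head , ∈tail) → let (_ , c′∈ , e₁) = ∈-map⁻ (_∷ ts) ∈head ; (_ , _ , e₂) = ∈-map⁻ (c ∷_) ∈tail in
          size-≢ (size-addLeaf m c c′∈) (∷-injectiveˡ (trans (sym e₁) e₂))
      where
      size-≢ : ∀ {t t′} → size t′ ≡ suc (size t) → t′ ≢ t
      size-≢ e refl = ℕP.1+n≢n (sym e)

  atMost3-node⁻ : ∀ {l cs} → AtMost3 (node l cs) → length cs < 4 × All AtMost3 cs
  atMost3-node⁻ {cs = cs} at3 = <ᵇ⇒< (T-∧⁻ˡ at3) , atMost3F⁻ cs (T-∧⁻ʳ {length cs ℕ.<ᵇ 4} at3)

  atMost3-node⁺ : ∀ {l cs} → length cs < 4 → All AtMost3 cs → AtMost3 (node l cs)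
  atMost3-node⁺ len< at3s = T-∧⁺ (<⇒<ᵇ len<) (atMost3F⁺ at3s)

  ∈-addLeaf-∷ : ∀ m l c {cs ps} → length (c ∷ cs) < 4 → node l cs ∈ addLeaf m (node l ps) →
    node l (c ∷ cs) ∈ addLeaf m (node l (c ∷ ps))
  ∈-addLeaf-∷ m l c {cs} {ps} len< t∈ with ∈-addLeaf⁻ m l ps t∈
  ... | inj₁ (_ , _ , cs∈ , refl) =
        ∈-addLeaf⁺-here m l (c ∷ ps) (<⇒<ᵇ (ℕP.≤-pred (subst (λ k → suc k < 4) (length-insertions (node m []) ps cs∈) len<)))
          (there (∈-map⁺ (c ∷_) cs∈))
  ... | inj₂ (_ , cs∈ , refl) = ∈-addLeaf⁺-below m l (c ∷ ps) (∈-addLeafF⁺-tail m c ps cs∈)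

  +≡1 : ∀ a b → a + b ≡ 1 → (a ≡ 0 × b ≡ 1) ⊎ (a ≡ 1 × b ≡ 0)
  +≡1 0 b e = inj₁ (refl , e)
  +≡1 1 b e = inj₂ (refl , ℕP.suc-injective e)
  +≡1 (suc (suc a)) b ()

  -- Induction on the first child: either m lies further right, or the first child is the leaf m
  -- (it cannot have children, whose labels would exceed m), or m lies strictly inside it.
  ∈-addLeaf-pruneF : ∀ m l cs → T (incrF l cs) → AtMost3 (node l cs) → occ m (labelsF cs) ≡ 1 →
    (∀ {a} → a ∈ labelsF cs → a ≤ m) → node l cs ∈ addLeaf m (node l (pruneF m cs))
  ∈-addLeaf-pruneF m l [] _ _ () _
  ∈-addLeaf-pruneF m l (c@(node l′ cc) ∷ cs) incr at3 occ≡1 ≤m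
    with +≡1 (occ m (labels c)) (occ m (labelsF cs)) (trans (sym (countᵇ-++ _ (labels c) (labelsF cs))) occ≡1)
  ... | inj₁ (occ-c≡0 , occ-cs≡1) =
        subst (λ ps → node l (c ∷ cs) ∈ addLeaf m (node l ps))
          (sym (trans (pruneF-≢ m c cs (λ e → m∉c (here (sym e)))) (cong (_∷ pruneF m cs) (prune-∉ m c m∉c))))
          (∈-addLeaf-∷ m l c len<
            (∈-addLeaf-pruneF m l cs (T-∧⁻ʳ {isIncreasing c} (T-∧⁻ʳ {l ℕ.<ᵇ l′} incr))
              (atMost3-node⁺ {l} (ℕP.<-trans (ℕP.n<1+n _) len<) at3s) occ-cs≡1 (λ a∈ → ≤m (∈-++⁺ʳ (labels c) a∈))))
    where
    m∉c = occ≡0⇒∉ (labels c) occ-c≡0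
    len< = proj₁ (atMost3-node⁻ {l} {c ∷ cs} at3)
    at3s = All.tail (proj₂ (atMost3-node⁻ {l} {c ∷ cs} at3))
  ... | inj₂ (occ-c≡1 , occ-cs≡0) with l′ ≟ m
  ∈-addLeaf-pruneF m l (node _ [] ∷ cs) incr at3 occ≡1 ≤m | inj₂ (_ , occ-cs≡0) | yes refl =
    subst (λ ps → node l (node m [] ∷ cs) ∈ addLeaf m (node l ps))
      (sym (trans (pruneF-≡ m (node m []) cs refl) (pruneF-∉ m cs (occ≡0⇒∉ (labelsF cs) occ-cs≡0))))
      (∈-addLeaf⁺-here m l cs (<⇒<ᵇ (ℕP.≤-pred (proj₁ (atMost3-node⁻ {l} {node m [] ∷ cs} at3)))) (∈-insertions⁺ (node m []) [] cs))
  ∈-addLeaf-pruneF m l (node _ (d ∷ _) ∷ cs) incr at3 occ≡1 ≤m | inj₂ _ | yes refl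
    with () ← ℕP.<⇒≱ (<ᵇ⇒< (T-∧⁻ˡ (T-∧⁻ˡ (T-∧⁻ʳ {l ℕ.<ᵇ m} incr)))) (≤m (∈-++⁺ˡ (there (∈-++⁺ˡ (root∈labels d)))))
  ... | no l′≢m =
        subst (λ ps → node l (c ∷ cs) ∈ addLeaf m (node l ps))
          (sym (trans (pruneF-≢ m c cs l′≢m) (cong (prune m c ∷_) (pruneF-∉ m cs (occ≡0⇒∉ (labelsF cs) occ-cs≡0)))))
          (∈-addLeaf⁺-below m l (prune m c ∷ cs) (∈-addLeafF⁺-head m (prune m c) cs
            (∈-addLeaf-pruneF m l′ cc (T-∧⁻ˡ (T-∧⁻ʳ {l ℕ.<ᵇ l′} incr)) (All.head (proj₂ (atMost3-node⁻ {l} {c ∷ cs} at3)))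
              (trans (sym (occ-≢ (labelsF cc) l′≢m)) occ-c≡1) (λ a∈ → ≤m (∈-++⁺ˡ (there a∈))))))

  root-prune : ∀ m t → root (prune m t) ≡ root t
  root-prune m (node _ _) = refl

  mutual
    prune-increasing : ∀ m t → T (isIncreasing t) → T (isIncreasing (prune m t))
    prune-increasing m (node l cs) incr = incrF⁺ (pruneF-increasing m l cs (incrF⁻ l cs incr))

    pruneF-increasing : ∀ m l cs → All (IncreasingBelow l) cs → All (IncreasingBelow l) (pruneF m cs)
    pruneF-increasing m l [] [] = []
    pruneF-increasing m l (c ∷ cs) ((l<c , incr) ∷ incrs) with root c ≟ m
    ... | yes e = subst (All (IncreasingBelow l)) (sym (pruneF-≡ m c cs e)) (pruneF-increasing m l cs incrs)
    ... | no e = subst (All (IncreasingBelow l)) (sym (pruneF-≢ m c cs e))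
                   ((subst (λ r → T (l ℕ.<ᵇ r)) (sym (root-prune m c)) l<c , prune-increasing m c incr) ∷ pruneF-increasing m l cs incrs)

  length-pruneF : ∀ m cs → length (pruneF m cs) ≤ length cs
  length-pruneF m [] = ℕ.z≤n
  length-pruneF m (c ∷ cs) with root c ≟ m
  ... | yes e = subst (λ ps → length ps ≤ suc (length cs)) (sym (pruneF-≡ m c cs e)) (ℕP.m≤n⇒m≤1+n (length-pruneF m cs))
  ... | no e = subst (λ ps → length ps ≤ suc (length cs)) (sym (pruneF-≢ m c cs e)) (s≤s (length-pruneF m cs))

  mutual
    prune-atMost3 : ∀ m t → AtMost3 t → AtMost3 (prune m t)
    prune-atMost3 m (node l cs) at3 = let (len< , at3s) = atMost3-node⁻ {l} {cs} at3 in
      atMost3-node⁺ {l} (ℕP.≤-<-trans (length-pruneF m cs) len<) (pruneF-atMost3 m cs at3s)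

    pruneF-atMost3 : ∀ m cs → All AtMost3 cs → All AtMost3 (pruneF m cs)
    pruneF-atMost3 m [] [] = []
    pruneF-atMost3 m (c ∷ cs) (at3 ∷ at3s) with root c ≟ m
    ... | yes e = subst (All AtMost3) (sym (pruneF-≡ m c cs e)) (pruneF-atMost3 m cs at3s)
    ... | no e = subst (All AtMost3) (sym (pruneF-≢ m c cs e)) (prune-atMost3 m c at3 ∷ pruneF-atMost3 m cs at3s)

module IncreasingTrees where

  open import Data.Nat as ℕ using (ℕ; zero; suc; _+_; _<_; _≤_; z≤n; s≤s; _≟_)
  open import Data.Nat.Properties as ℕP using ()
  open import Data.Bool using (T)
  open import Data.Empty using (⊥)
  open import Data.Product using (_×_; _,_; proj₁; proj₂)
  open import Data.Sum using (_⊎_; inj₁; inj₂)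
  open import Data.List using (List; []; _∷_; map; _++_; concatMap; length)
  open import Data.List.Properties using (length-++-≤ˡ; length-++-≤ʳ; ∷-injective)
  open import Data.List.Membership.Propositional using (_∈_; _∉_)
  open import Data.List.Membership.Propositional.Properties using (∈-map⁺; ∈-map⁻; ∈-++⁺ˡ; ∈-++⁺ʳ; ∈-++⁻; ∈-upTo⁺; ∈-upTo⁻)
  open import Data.List.Relation.Unary.Any using (here; there)
  open import Data.List.Relation.Unary.All as All using (All; []; _∷_)
  open import Data.List.Relation.Unary.Unique.Propositional using (Unique)
  open import Data.List.Relation.Unary.AllPairs using ([]; _∷_)
  import Data.List.Relation.Unary.Unique.Propositional.Properties as Unique
  open import Data.List.Relation.Binary.Permutation.Propositional using (_↭_)
  open import Relation.Binary.PropositionalEquality using (_≡_; _≢_; refl; sym; trans; cong; subst)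
  open import Relation.Nullary using (yes; no)
  open ListLemmas
  open StirlingPermutations using (occ-≡; occ-≢; occ-∉; occ≡0⇒∉)
  open TreeGrowth

  ∈-listsOfLen⁻ : ∀ k ts {cs} → cs ∈ listsOfLen k ts → length cs ≡ k × All (_∈ ts) cs
  ∈-listsOfLen⁻ zero ts (here refl) = refl , []
  ∈-listsOfLen⁻ (suc k) ts cs∈ with ∈-concatMap⁻ (λ t → map (t ∷_) (listsOfLen k ts)) ts cs∈
  ... | t , t∈ , cs∈′ with ∈-map⁻ (t ∷_) cs∈′
  ... | cs , cs∈″ , refl = let (len≡ , cs⊆) = ∈-listsOfLen⁻ k ts cs∈″ in cong suc len≡ , t∈ ∷ cs⊆

  ∈-listsOfLen⁺ : ∀ ts {cs} → All (_∈ ts) cs → cs ∈ listsOfLen (length cs) ts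
  ∈-listsOfLen⁺ ts [] = here refl
  ∈-listsOfLen⁺ ts {c ∷ cs} (c∈ ∷ cs⊆) =
    ∈-concatMap⁺ (λ t → map (t ∷_) (listsOfLen (length cs) ts)) c∈ (∈-map⁺ (c ∷_) (∈-listsOfLen⁺ ts cs⊆))

  listsOfLen-unique : ∀ k ts → Unique ts → Unique (listsOfLen k ts)
  listsOfLen-unique zero ts _ = [] ∷ []
  listsOfLen-unique (suc k) ts u = concatMap-map-unique _∷_ ∷-injective u (listsOfLen-unique k ts u)

  childLists : List Tree → List (List Tree)
  childLists ts = concatMap (λ k → listsOfLen k ts) (range0 3)

  ∈-childLists⁻ : ∀ ts {cs} → cs ∈ childLists ts → length cs < 4 × All (_∈ ts) cs
  ∈-childLists⁻ ts cs∈ with ∈-concatMap⁻ (λ k → listsOfLen k ts) (range0 3) cs∈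
  ... | k , k∈ , cs∈′ = let (len≡ , cs⊆) = ∈-listsOfLen⁻ k ts cs∈′ in subst (_< 4) (sym len≡) (∈-upTo⁻ k∈) , cs⊆

  ∈-childLists⁺ : ∀ ts {cs} → length cs < 4 → All (_∈ ts) cs → cs ∈ childLists ts
  ∈-childLists⁺ ts len< cs⊆ = ∈-concatMap⁺ (λ k → listsOfLen k ts) (∈-upTo⁺ len<) (∈-listsOfLen⁺ ts cs⊆)

  childLists-unique : ∀ ts → Unique ts → Unique (childLists ts)
  childLists-unique ts u = concatMap-unique (λ k → listsOfLen k ts) length (Unique.upTo⁺ 4)
    (λ {k} _ → listsOfLen-unique k ts u) (λ {k} _ cs∈ → proj₁ (∈-listsOfLen⁻ k ts cs∈))

  InTreesUpTo : ℕ → ℕ → Tree → Set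
  InTreesUpTo n zero t = ⊥
  InTreesUpTo n (suc d) (node l cs) = l ∈ range n × length cs < 4 × All (InTreesUpTo n d) cs

  ∈-treesUpTo⁻ : ∀ n d {t} → t ∈ treesUpTo n d → InTreesUpTo n d t
  ∈-treesUpTo⁻ n (suc d) t∈ with ∈-concatMap⁻ (λ l → map (node l) (childLists (treesUpTo n d))) (range n) t∈
  ... | l , l∈ , t∈′ with ∈-map⁻ (node l) t∈′
  ... | cs , cs∈ , refl = let (len< , cs⊆) = ∈-childLists⁻ _ cs∈ in l∈ , len< , All.map (∈-treesUpTo⁻ n d) cs⊆

  ∈-treesUpTo⁺ : ∀ n d {t} → InTreesUpTo n d t → t ∈ treesUpTo n d
  ∈-treesUpTo⁺ n (suc d) {node l cs} (l∈ , len< , cs⊆) =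
    ∈-concatMap⁺ (λ l → map (node l) (childLists (treesUpTo n d))) l∈
      (∈-map⁺ (node l) (∈-childLists⁺ _ len< (All.map (∈-treesUpTo⁺ n d) cs⊆)))

  treesUpTo-unique : ∀ n d → Unique (treesUpTo n d)
  treesUpTo-unique n zero = []
  treesUpTo-unique n (suc d) =
    concatMap-unique (λ l → map (node l) (childLists (treesUpTo n d))) root (range-unique n)
      (λ _ → Unique.map⁺ node-injectiveʳ (childLists-unique _ (treesUpTo-unique n d)))
      root-key
    where
    root-key : ∀ {l t} → l ∈ range n → t ∈ map (node l) (childLists (treesUpTo n d)) → root t ≡ l
    root-key {l} _ t∈ with ∈-map⁻ (node l) t∈
    ... | _ , _ , refl = refl

  InTreesUpTo-mono : ∀ n {d d′} t → d ≤ d′ → InTreesUpTo n d t → InTreesUpTo n d′ t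
  InTreesUpTo-mono n {suc d} {suc d′} (node l cs) (s≤s d≤d′) (l∈ , len< , cs⊆) = l∈ , len< , monoF cs cs⊆
    where
    monoF : ∀ cs → All (InTreesUpTo n d) cs → All (InTreesUpTo n d′) cs
    monoF [] [] = []
    monoF (c ∷ cs) (c∈ ∷ cs⊆) = InTreesUpTo-mono n c d≤d′ c∈ ∷ monoF cs cs⊆

  -- The depth of a tree is at most its number of vertices.
  mutual
    InTreesUpTo-size : ∀ n t → (∀ {a} → a ∈ labels t → a ∈ range n) → AtMost3 t → InTreesUpTo n (size t) t
    InTreesUpTo-size n (node l cs) labels⊆ at3 = let (len< , at3s) = atMost3-node⁻ {l} {cs} at3 in
      labels⊆ (here refl) , len< , InTreesUpTo-sizeF n cs (λ a∈ → labels⊆ (there a∈)) at3s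

    InTreesUpTo-sizeF : ∀ n cs → (∀ {a} → a ∈ labelsF cs → a ∈ range n) → All AtMost3 cs →
      All (InTreesUpTo n (length (labelsF cs))) cs
    InTreesUpTo-sizeF n [] _ _ = []
    InTreesUpTo-sizeF n (c ∷ cs) labels⊆ (at3 ∷ at3s) =
      InTreesUpTo-mono n c (length-++-≤ˡ (labels c)) (InTreesUpTo-size n c (λ a∈ → labels⊆ (∈-++⁺ˡ a∈)) at3)
      ∷ All.map (λ {c′} → InTreesUpTo-mono n c′ (length-++-≤ʳ (labelsF cs) {labels c}))
                (InTreesUpTo-sizeF n cs (λ a∈ → labels⊆ (∈-++⁺ʳ (labels c) a∈)) at3s)

  mutual
    labels-InTreesUpTo : ∀ n d t → InTreesUpTo n d t → ∀ {a} → a ∈ labels t → a ∈ range n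
    labels-InTreesUpTo n (suc d) (node l cs) (l∈ , _ , _) (here refl) = l∈
    labels-InTreesUpTo n (suc d) (node l cs) (_ , _ , cs⊆) (there a∈) = labelsF-InTreesUpTo n d cs cs⊆ a∈

    labelsF-InTreesUpTo : ∀ n d cs → All (InTreesUpTo n d) cs → ∀ {a} → a ∈ labelsF cs → a ∈ range n
    labelsF-InTreesUpTo n d (c ∷ cs) (c∈ ∷ cs⊆) a∈ with ∈-++⁻ (labels c) a∈
    ... | inj₁ a∈c = labels-InTreesUpTo n d c c∈ a∈c
    ... | inj₂ a∈cs = labelsF-InTreesUpTo n d cs cs⊆ a∈cs

  record Is0123IPT (n : ℕ) (t : Tree) : Set where
    field
      listed     : InTreesUpTo n n t
      len        : length (labels t) ≡ n
      once       : ∀ {j} → j ∈ range n → occ j (labels t) ≡ 1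
      increasing : T (isIncreasing t)
      at3        : AtMost3 t

    labels⊆ : ∀ {a} → a ∈ labels t → a ∈ range n
    labels⊆ = labels-InTreesUpTo n n t listed

  ∈-IPT0123⁻ : ∀ n {t} → t ∈ IPT0123 n → Is0123IPT n t
  ∈-IPT0123⁻ n {t} t∈ =
    let (t∈′ , h) = ∈-filterᵇ⁻ (is0123IPT n) (treesUpTo n n) t∈
        h₂ = T-∧⁻ʳ {length (labels t) ℕ.≡ᵇ n} h
        h₃ = T-∧⁻ʳ {allᵇ (λ j → occ j (labels t) ℕ.≡ᵇ 1) (range n)} h₂
    in record
    { listed = ∈-treesUpTo⁻ n n t∈′
    ; len = ≡ᵇ⇒≡ (T-∧⁻ˡ h)
    ; once = λ j∈ → ≡ᵇ⇒≡ (allᵇ⁻ (T-∧⁻ˡ h₂) j∈)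
    ; increasing = T-∧⁻ˡ h₃
    ; at3 = T-∧⁻ʳ {isIncreasing t} h₃
    }

  ∈-IPT0123⁺ : ∀ n {t} → Is0123IPT n t → t ∈ IPT0123 n
  ∈-IPT0123⁺ n {t} ipt = ∈-filterᵇ⁺ (is0123IPT n) (∈-treesUpTo⁺ n n listed)
    (T-∧⁺ (≡⇒≡ᵇ len) (T-∧⁺ (allᵇ⁺ (λ j∈ → ≡⇒≡ᵇ (once j∈))) (T-∧⁺ increasing at3)))
    where open Is0123IPT ipt

  IPT0123-unique : ∀ n → Unique (IPT0123 n)
  IPT0123-unique n = filterᵇ-unique (is0123IPT n) (treesUpTo-unique n n)

  suc∉labels : ∀ {n t} → Is0123IPT n t → suc n ∉ labels t
  suc∉labels ipt n+1∈ = ℕP.<-irrefl refl (proj₂ (∈-range⁻ (Is0123IPT.labels⊆ ipt n+1∈)))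

  ∈-insert⁺ : ∀ {a m : ℕ} p s → a ∈ p ++ s → a ∈ p ++ m ∷ s
  ∈-insert⁺ p s a∈ with ∈-++⁻ p a∈
  ... | inj₁ a∈p = ∈-++⁺ˡ a∈p
  ... | inj₂ a∈s = ∈-++⁺ʳ p (there a∈s)

  ∈-insert⁻ : ∀ {a m : ℕ} p s → a ∈ p ++ m ∷ s → a ≡ m ⊎ a ∈ p ++ s
  ∈-insert⁻ p s a∈ with ∈-++⁻ p a∈
  ... | inj₁ a∈p = inj₂ (∈-++⁺ˡ a∈p)
  ... | inj₂ (here e) = inj₁ e
  ... | inj₂ (there a∈s) = inj₂ (∈-++⁺ʳ p a∈s)

  occ-insert-≢ : ∀ {j m : ℕ} p s → j ≢ m → occ j (p ++ m ∷ s) ≡ occ j (p ++ s)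
  occ-insert-≢ {j} {m} p s j≢m = trans (countᵇ-++ _ p (m ∷ s))
    (trans (cong (occ j p +_) (occ-≢ s (λ e → j≢m (sym e)))) (sym (countᵇ-++ _ p s)))

  occ-insert-≡ : ∀ m p s → occ m (p ++ m ∷ s) ≡ suc (occ m (p ++ s))
  occ-insert-≡ m p s = trans (countᵇ-++ _ p (m ∷ s))
    (trans (cong (occ m p +_) (occ-≡ m s)) (trans (ℕP.+-suc _ _) (cong suc (sym (countᵇ-++ _ p s)))))

  Is0123IPT-addLeaf : ∀ n {t₀ t} → Is0123IPT n t₀ → t ∈ addLeaf (suc n) t₀ → Is0123IPT (suc n) t
  Is0123IPT-addLeaf n {t₀} {t} ipt t∈ with labels-addLeaf (suc n) t₀ t∈
  ... | p , s , e₁ , e₂ = record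
    { listed = subst (λ k → InTreesUpTo m k t) len′ (InTreesUpTo-size m t labels⊆′ at3′)
    ; len = len′
    ; once = once′
    ; increasing = addLeaf-increasing m t₀ t∈ increasing (λ a∈ → proj₂ (∈-range⁻ (labels⊆ a∈)))
    ; at3 = at3′
    }
    where
    open Is0123IPT ipt
    m = suc n
    len′ : length (labels t) ≡ m
    len′ = trans (size-addLeaf m t₀ t∈) (cong suc len)
    at3′ : AtMost3 t
    at3′ = addLeaf-atMost3 m t₀ t∈ at3
    labels⊆′ : ∀ {a} → a ∈ labels t → a ∈ range m
    labels⊆′ {a} a∈ with ∈-insert⁻ {a} {m} p s (subst (a ∈_) e₂ a∈)
    ... | inj₁ refl = max∈range n
    ... | inj₂ a∈′ = ∈-range-suc (labels⊆ (subst (a ∈_) (sym e₁) a∈′))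
    once′ : ∀ {j} → j ∈ range m → occ j (labels t) ≡ 1
    once′ {j} j∈ with j ≟ m
    ... | yes refl = trans (cong (occ m) e₂) (trans (occ-insert-≡ m p s)
                       (cong suc (occ-∉ (p ++ s) (λ m∈ → suc∉labels ipt (subst (_ ∈_) (sym e₁) m∈)))))
    ... | no j≢m = trans (cong (occ j) e₂) (trans (occ-insert-≢ p s j≢m)
                     (trans (cong (occ j) (sym e₁)) (once (∈-range-pred j∈ j≢m))))

  -- The largest label is a leaf, and it is not the root because 1 is also a label.
  ∈-addLeaf-prune : ∀ n {t} → 1 ≤ n → Is0123IPT (suc n) t → t ∈ addLeaf (suc n) (prune (suc n) t)
  ∈-addLeaf-prune (suc k) {node l cs} _ ipt with l ≟ suc (suc k)
  ∈-addLeaf-prune (suc k) {node _ []} _ ipt | yes refl with () ← Is0123IPT.once ipt {1} (∈-range⁺ (s≤s z≤n) (s≤s (s≤s z≤n)))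
  ∈-addLeaf-prune (suc k) {node _ (d ∷ _)} _ ipt | yes refl with () ←
    ℕP.<⇒≱ (<ᵇ⇒< (T-∧⁻ˡ (Is0123IPT.increasing ipt)))
      (ℕP.≤-pred (proj₂ (∈-range⁻ (Is0123IPT.labels⊆ ipt (there (∈-++⁺ˡ (root∈labels d)))))))
  ∈-addLeaf-prune (suc k) {node l cs} _ ipt | no l≢m =
    ∈-addLeaf-pruneF m l cs increasing at3 (trans (sym (occ-≢ (labelsF cs) l≢m)) (once (max∈range (suc k))))
      (λ a∈ → ℕP.≤-pred (proj₂ (∈-range⁻ (labels⊆ (there a∈)))))
    where
    open Is0123IPT ipt
    m = suc (suc k)

  Is0123IPT-prune : ∀ n {t} → Is0123IPT (suc n) t → t ∈ addLeaf (suc n) (prune (suc n) t) → Is0123IPT n (prune (suc n) t)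
  Is0123IPT-prune n {t} ipt t∈ with labels-addLeaf (suc n) (prune (suc n) t) t∈
  ... | p , s , e₁ , e₂ = record
    { listed = subst (λ j → InTreesUpTo n j t₀) len₀ (InTreesUpTo-size n t₀ labels⊆₀ at3₀)
    ; len = len₀
    ; once = λ {j} j∈ → trans (cong (occ j) e₁)
        (trans (sym (occ-insert-≢ p s (λ e → ℕP.<-irrefl e (proj₂ (∈-range⁻ j∈)))))
          (trans (cong (occ j) (sym e₂)) (once (∈-range-suc j∈))))
    ; increasing = prune-increasing m t increasing
    ; at3 = at3₀
    }
    where
    open Is0123IPT ipt
    m = suc n
    t₀ = prune m t
    at3₀ : AtMost3 t₀
    at3₀ = prune-atMost3 m t at3
    len₀ : length (labels t₀) ≡ n
    len₀ = ℕP.suc-injective (trans (sym (size-addLeaf m t₀ t∈)) len)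
    m∉ : m ∉ p ++ s
    m∉ = occ≡0⇒∉ (p ++ s) (ℕP.suc-injective (trans (sym (occ-insert-≡ m p s)) (trans (cong (occ m) (sym e₂)) (once (max∈range n)))))
    labels⊆₀ : ∀ {a} → a ∈ labels t₀ → a ∈ range n
    labels⊆₀ {a} a∈ = let a∈′ = subst (a ∈_) e₁ a∈ in
      ∈-range-pred (labels⊆ (subst (a ∈_) (sym e₂) (∈-insert⁺ p s a∈′))) (λ e → m∉ (subst (_∈ p ++ s) e a∈′))

  IPT0123-suc↭ : ∀ n → 1 ≤ n → IPT0123 (suc n) ↭ concatMap (addLeaf (suc n)) (IPT0123 n)
  IPT0123-suc↭ n 1≤n = unique∧set⇒↭ (IPT0123-unique (suc n))
    (concatMap-unique (addLeaf (suc n)) (prune (suc n)) (IPT0123-unique n)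
      (λ {t₀} t₀∈ → addLeaf-unique (suc n) t₀ (suc∉labels (∈-IPT0123⁻ n t₀∈)))
      (λ {t₀} t₀∈ → prune-addLeaf (suc n) t₀ (suc∉labels (∈-IPT0123⁻ n t₀∈))))
    (λ t∈ → let ipt = ∈-IPT0123⁻ (suc n) t∈ ; t∈′ = ∈-addLeaf-prune n 1≤n ipt in
      ∈-concatMap⁺ (addLeaf (suc n)) (∈-IPT0123⁺ n (Is0123IPT-prune n ipt t∈′)) t∈′)
    (λ t∈ → let (t₀ , t₀∈ , t∈′) = ∈-concatMap⁻ (addLeaf (suc n)) (IPT0123 n) t∈ in
      ∈-IPT0123⁺ (suc n) (Is0123IPT-addLeaf n (∈-IPT0123⁻ n t₀∈) t∈′))

module TreeWeights {c ℓ : Level} (R : CommutativeSemiring c ℓ) (x y z : CommutativeSemiring.Carrier R) where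

  open import Data.Nat as ℕ using (ℕ; suc)
  open import Data.List using (List; []; _∷_; length)
  open CommutativeSemiring R
  open import Algebra.Definitions.RawSemiring rawSemiring using () renaming (_×_ to _·_)
  open import Algebra.Properties.Semiring.Mult semiring using (×-congʳ; ×-comm-*)
  open import Algebra.Solver.Ring.NaturalCoefficients.Default R
  open ListLemmas using (insertions)
  open Sums R
  open Poly R using (e₁; e₂; e₃)

  degreeWeight : ℕ → Carrier
  degreeWeight 0 = e₃ x y z
  degreeWeight 1 = e₂ x y z
  degreeWeight 2 = e₁ x y z
  degreeWeight _ = 1#

  mutual
    treeWeight : Tree → Carrier
    treeWeight (node _ cs) = degreeWeight (length cs) * forestWeight cs

    forestWeight : List Tree → Carrier
    forestWeight [] = 1#
    forestWeight (t ∷ ts) = treeWeight t * forestWeight ts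

  ∑-insertions : ∀ u cs (g : ℕ → Carrier) →
    ∑ (insertions u cs) (λ cs′ → g (length cs′) * forestWeight cs′)
      ≈ suc (length cs) · (g (suc (length cs)) * (treeWeight u * forestWeight cs))
  ∑-insertions u [] g = refl
  ∑-insertions u (t ∷ ts) g =
    +-congˡ (trans (∑-map (insertions u ts) (t ∷_) _)
      (trans (∑-cong (insertions u ts) (λ _ → solve 3 (λ a b c → a :* (b :* c) := b :* (a :* c)) refl _ _ _))
        (trans (sym (*-distribˡ-∑ (insertions u ts) (treeWeight t) (λ cs′ → g (suc (length cs′)) * forestWeight cs′)))
          (trans (*-congˡ (∑-insertions u ts (λ k → g (suc k))))
            (trans (×-comm-* (suc (length ts)) _ _)
              (×-congʳ (suc (length ts)) (solve 4 (λ a b c d → a :* (b :* (c :* d)) := b :* (c :* (a :* d))) refl _ _ _ _)))))))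

module TreeRecurrence {c ℓ : Level} (R : CommutativeSemiring c ℓ) (x y z : CommutativeSemiring.Carrier R) where

  open import Data.Nat as ℕ using (ℕ; suc)
  open import Data.Product using (proj₁; proj₂)
  open import Data.List using ([]; _∷_; map; length)
  import Relation.Binary.PropositionalEquality as P
  open CommutativeSemiring R
  open import Algebra.Definitions.RawSemiring rawSemiring using () renaming (_×_ to _·_)
  open import Algebra.Properties.Semiring.Mult semiring using (×-congʳ)
  open import Algebra.Solver.Ring.NaturalCoefficients.Default R
  open ListLemmas using (insertions)
  open TreeGrowth using (attachHere; addLeaf; addLeafF)
  open Sums R
  open Poly R using (e₁; e₂; e₃)
  open DualNumbers R using (Dual; _+ε)
  open TreeWeights R x y z
  module Wε = TreeWeights Dual (x +ε) (y +ε) (z +ε)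

  degreeWeight-ε : ∀ d → proj₁ (Wε.degreeWeight d) ≈ degreeWeight d
  degreeWeight-ε 0 = refl
  degreeWeight-ε 1 = refl
  degreeWeight-ε 2 = refl
  degreeWeight-ε (suc (suc (suc d))) = refl

  mutual
    treeWeight-ε : ∀ t → proj₁ (Wε.treeWeight t) ≈ treeWeight t
    treeWeight-ε (node l cs) = *-cong (degreeWeight-ε (length cs)) (forestWeight-ε cs)

    forestWeight-ε : ∀ ts → proj₁ (Wε.forestWeight ts) ≈ forestWeight ts
    forestWeight-ε [] = refl
    forestWeight-ε (t ∷ ts) = *-cong (treeWeight-ε t) (forestWeight-ε ts)

  ∑-insertLeaf : ∀ m l cs {d} → length cs P.≡ d →
    ∑ (map (node l) (insertions (node m []) cs)) treeWeight ≈ suc d · (degreeWeight (suc d) * (e₃ x y z * forestWeight cs))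
  ∑-insertLeaf m l cs P.refl =
    trans (∑-map (insertions (node m []) cs) (node l) treeWeight)
      (trans (∑-insertions (node m []) cs degreeWeight) (×-congʳ (suc (length cs)) (*-congˡ (*-congʳ (*-identityʳ _)))))

  -- (d + 1) · w_{d+1} · e₃ = e₃ · D w_d, where D e₃ = e₂, D e₂ = 2 e₁, D e₁ = 3 and D 1 = 0.
  ∑-attachHere : ∀ m l cs →
    ∑ (attachHere m l cs) treeWeight ≈ e₃ x y z * proj₂ (Wε.degreeWeight (length cs)) * forestWeight cs
  ∑-attachHere m l cs with length cs in len≡
  ... | 0 = trans (∑-insertLeaf m l cs len≡)
              (solve 4 (λ x y z f → (x :* y :+ x :* z :+ y :* z) :* (x :* y :* z :* f) :+ con 0
                 := x :* y :* z :* (x :* y :* con 1 :+ (x :* con 1 :+ con 1 :* y) :* z) :* f) refl x y z (forestWeight cs))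
  ... | 1 = trans (∑-insertLeaf m l cs len≡)
              (solve 4 (λ x y z f → (x :+ y :+ z) :* (x :* y :* z :* f) :+ ((x :+ y :+ z) :* (x :* y :* z :* f) :+ con 0)
                 := x :* y :* z :* ((x :* con 1 :+ con 1 :* y) :+ (x :* con 1 :+ con 1 :* z) :+ (y :* con 1 :+ con 1 :* z)) :* f)
                 refl x y z (forestWeight cs))
  ... | 2 = trans (∑-insertLeaf m l cs len≡)
              (solve 4 (λ x y z f → con 1 :* (x :* y :* z :* f) :+ (con 1 :* (x :* y :* z :* f) :+ (con 1 :* (x :* y :* z :* f) :+ con 0))
                 := x :* y :* z :* (con 1 :+ con 1 :+ con 1) :* f) refl x y z (forestWeight cs))
  ... | suc (suc (suc _)) = sym (trans (*-congʳ (zeroʳ _)) (zeroˡ _))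

  mutual
    ∑-addLeaf : ∀ m t → ∑ (addLeaf m t) treeWeight ≈ e₃ x y z * proj₂ (Wε.treeWeight t)
    ∑-addLeaf m (node l cs) =
      trans (∑-++ (attachHere m l cs) (map (node l) (addLeafF m cs)) treeWeight)
        (trans (+-cong (∑-attachHere m l cs) (trans (∑-map (addLeafF m cs) (node l) treeWeight) (∑-addLeafF m cs degreeWeight)))
          (trans (+-cong (*-congˡ (sym (forestWeight-ε cs))) (*-congʳ (sym (degreeWeight-ε (length cs)))))
            (solve 5 (λ e w′ f f′ w → e :* w′ :* f :+ w :* (e :* f′) := e :* (w :* f′ :+ w′ :* f)) refl
              (e₃ x y z) (proj₂ (Wε.degreeWeight (length cs))) (proj₁ (Wε.forestWeight cs))
              (proj₂ (Wε.forestWeight cs)) (proj₁ (Wε.degreeWeight (length cs))))))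

    ∑-addLeafF : ∀ m ts (g : ℕ → Carrier) →
      ∑ (addLeafF m ts) (λ cs → g (length cs) * forestWeight cs) ≈ g (length ts) * (e₃ x y z * proj₂ (Wε.forestWeight ts))
    ∑-addLeafF m [] g = sym (trans (*-congˡ (zeroʳ _)) (zeroʳ _))
    ∑-addLeafF m (t ∷ ts) g =
      trans (∑-++ (map (_∷ ts) (addLeaf m t)) (map (t ∷_) (addLeafF m ts)) _)
        (trans (+-cong inHead inTail)
          (trans (+-cong (*-congʳ (*-congˡ (sym (forestWeight-ε ts)))) (*-congʳ (sym (treeWeight-ε t))))
            (solve 6 (λ G F E p′ T f′ → G :* F :* (E :* p′) :+ T :* (G :* (E :* f′)) := G :* (E :* (T :* f′ :+ p′ :* F))) refl
              (g (suc (length ts))) (proj₁ (Wε.forestWeight ts)) (e₃ x y z) (proj₂ (Wε.treeWeight t))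
              (proj₁ (Wε.treeWeight t)) (proj₂ (Wε.forestWeight ts)))))
      where
      inHead : ∑ (map (_∷ ts) (addLeaf m t)) (λ cs → g (length cs) * forestWeight cs)
               ≈ g (suc (length ts)) * forestWeight ts * (e₃ x y z * proj₂ (Wε.treeWeight t))
      inHead = trans (∑-map (addLeaf m t) (_∷ ts) _)
                 (trans (∑-cong (addLeaf m t) (λ _ → solve 3 (λ a b c → a :* (b :* c) := a :* c :* b) refl _ _ _))
                   (trans (sym (*-distribˡ-∑ (addLeaf m t) (g (suc (length ts)) * forestWeight ts) treeWeight))
                     (*-congˡ (∑-addLeaf m t))))
      inTail : ∑ (map (t ∷_) (addLeafF m ts)) (λ cs → g (length cs) * forestWeight cs)
               ≈ treeWeight t * (g (suc (length ts)) * (e₃ x y z * proj₂ (Wε.forestWeight ts)))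
      inTail = trans (∑-map (addLeafF m ts) (t ∷_) _)
                 (trans (∑-cong (addLeafF m ts) (λ _ → solve 3 (λ a b c → a :* (b :* c) := b :* (a :* c)) refl _ _ _))
                   (trans (sym (*-distribˡ-∑ (addLeafF m ts) (treeWeight t) (λ cs → g (suc (length cs)) * forestWeight cs)))
                     (*-congˡ (∑-addLeafF m ts (λ k → g (suc k))))))

module DegreeProfiles where

  open import Data.Nat as ℕ using (ℕ; suc; _+_; _*_; _<_; _≤_; s≤s)
  open import Data.Nat.Properties as ℕP using ()
  open import Data.Nat.Tactic.RingSolver using (solve-∀)
  open import Data.Bool using (Bool; T; _∧_)
  open import Data.Product using (_,_; proj₁; proj₂)
  open import Data.List using (List; []; _∷_; map; concatMap; length)
  open import Data.List.Properties using (length-++)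
  open import Data.List.Membership.Propositional using (_∈_)
  open import Data.List.Membership.Propositional.Properties using (∈-map⁺; ∈-map⁻; ∈-upTo⁺)
  open import Data.List.Relation.Unary.All using (All; []; _∷_)
  open import Data.List.Relation.Unary.Unique.Propositional using (Unique)
  import Data.List.Relation.Unary.Unique.Propositional.Properties as Unique
  open import Relation.Binary.PropositionalEquality using (_≡_; refl; sym; trans; cong; cong₂; subst; module ≡-Reasoning)
  open ListLemmas
  open TripleMonomials using (Triple; _+³_)
  open TreeGrowth using (size; atMost3-node⁻)
  open IncreasingTrees using (module Is0123IPT; ∈-IPT0123⁻)

  degreeIndicators : ℕ → Triple
  degreeIndicators d = (indicator (d ℕ.≡ᵇ 2) , indicator (d ℕ.≡ᵇ 1) , indicator (d ℕ.≡ᵇ 0))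

  degreeProfile : Tree → Triple
  degreeProfile t = (degCount 2 t , degCount 1 t , degCount 0 t)

  forestProfile : List Tree → Triple
  forestProfile ts = (degCountF 2 ts , degCountF 1 ts , degCountF 0 ts)

  weigh : Triple → ℕ
  weigh (i , j , k) = i + 2 * j + 3 * k

  weigh-+³ : ∀ s t → weigh (s +³ t) ≡ weigh s + weigh t
  weigh-+³ (i , j , k) (i′ , j′ , k′) = lemma i j k i′ j′ k′
    where
    lemma : ∀ i j k i′ j′ k′ → (i + i′) + 2 * (j + j′) + 3 * (k + k′) ≡ (i + 2 * j + 3 * k) + (i′ + 2 * j′ + 3 * k′)
    lemma = solve-∀

  weigh-degreeIndicators : ∀ d → d < 4 → weigh (degreeIndicators d) + d ≡ 3
  weigh-degreeIndicators 0 _ = refl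
  weigh-degreeIndicators 1 _ = refl
  weigh-degreeIndicators 2 _ = refl
  weigh-degreeIndicators 3 _ = refl
  weigh-degreeIndicators (suc (suc (suc (suc _)))) (s≤s (s≤s (s≤s (s≤s ()))))

  -- Counting the vertices of degree 0, 1, 2 (and 3) against the edges: 3k + 2j + i = 2|t| + 1.
  mutual
    weigh-degreeProfile : ∀ t → T (atMost3 t) → weigh (degreeProfile t) ≡ 2 * size t + 1
    weigh-degreeProfile (node l cs) at3 = begin
      weigh (degreeIndicators d +³ forestProfile cs)        ≡⟨ weigh-+³ (degreeIndicators d) (forestProfile cs) ⟩
      weigh (degreeIndicators d) + weigh (forestProfile cs)  ≡⟨ cong (weigh (degreeIndicators d) +_) (weigh-forestProfile cs at3s) ⟩
      weigh (degreeIndicators d) + (2 * L + d)               ≡⟨ rearrange (weigh (degreeIndicators d)) L d ⟩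
      (weigh (degreeIndicators d) + d) + 2 * L               ≡⟨ cong (_+ 2 * L) (weigh-degreeIndicators d d<4) ⟩
      3 + 2 * L                                              ≡⟨ close L ⟩
      2 * suc L + 1                                          ∎
      where
      open ≡-Reasoning
      d = length cs
      d<4 = proj₁ (atMost3-node⁻ {l} {cs} at3)
      at3s = proj₂ (atMost3-node⁻ {l} {cs} at3)
      L = length (labelsF cs)
      rearrange : ∀ a L d → a + (2 * L + d) ≡ (a + d) + 2 * L
      rearrange = solve-∀
      close : ∀ L → 3 + 2 * L ≡ 2 * suc L + 1
      close = solve-∀

    weigh-forestProfile : ∀ cs → All (λ c → T (atMost3 c)) cs → weigh (forestProfile cs) ≡ 2 * length (labelsF cs) + length cs
    weigh-forestProfile [] [] = refl
    weigh-forestProfile (c ∷ cs) (at3 ∷ at3s) = begin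
      weigh (degreeProfile c +³ forestProfile cs)             ≡⟨ weigh-+³ (degreeProfile c) (forestProfile cs) ⟩
      weigh (degreeProfile c) + weigh (forestProfile cs)      ≡⟨ cong₂ _+_ (weigh-degreeProfile c at3) (weigh-forestProfile cs at3s) ⟩
      (2 * size c + 1) + (2 * length (labelsF cs) + length cs) ≡⟨ regroup (size c) (length (labelsF cs)) (length cs) ⟩
      2 * (size c + length (labelsF cs)) + suc (length cs)    ≡⟨ cong (λ L → 2 * L + suc (length cs)) (sym (length-++ (labels c))) ⟩
      2 * length (labelsF (c ∷ cs)) + length (c ∷ cs)         ∎
      where
      open ≡-Reasoning
      regroup : ∀ a b c → (2 * a + 1) + (2 * b + c) ≡ 2 * (a + b) + suc c
      regroup = solve-∀

  ∈-triples : ∀ n i j k → weigh (i , j , k) ≡ 2 * n + 1 → (i , j , k) ∈ triples n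
  ∈-triples n i j k weigh≡ = ∈-filterᵇ⁺ _
    (∈-concatMap⁺ (λ i → concatMap (λ j → map (λ k → (i , j , k)) box) box) (∈-upTo⁺ (s≤s (bound i i≤)))
      (∈-concatMap⁺ (λ j → map (λ k → (i , j , k)) box) (∈-upTo⁺ (s≤s (bound j j≤))) (∈-map⁺ (λ k → (i , j , k)) (∈-upTo⁺ (s≤s (bound k k≤))))))
    (≡⇒≡ᵇ weigh≡)
    where
    box = range0 (2 * n + 1)
    bound : ∀ a → a ≤ weigh (i , j , k) → a ≤ 2 * n + 1
    bound a a≤ = subst (a ≤_) weigh≡ a≤
    i≤ : i ≤ weigh (i , j , k)
    i≤ = ℕP.≤-trans (ℕP.m≤m+n i (2 * j)) (ℕP.m≤m+n (i + 2 * j) (3 * k))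
    j≤ : j ≤ weigh (i , j , k)
    j≤ = ℕP.≤-trans (ℕP.≤-trans (ℕP.m≤m+n j (j + 0)) (ℕP.m≤n+m (2 * j) i)) (ℕP.m≤m+n (i + 2 * j) (3 * k))
    k≤ : k ≤ weigh (i , j , k)
    k≤ = ℕP.≤-trans (ℕP.m≤m+n k (2 * k)) (ℕP.m≤n+m (3 * k) (i + 2 * j))

  triples-unique : ∀ n → Unique (triples n)
  triples-unique n = filterᵇ-unique _
    (concatMap-unique (λ i → concatMap (λ j → map (λ k → (i , j , k)) box) box) proj₁ box-unique
      (λ {i} _ → concatMap-map-unique (λ j k → (i , j , k)) (λ { refl → refl , refl }) box-unique box-unique)
      (λ {i} _ τ∈ → let (j , _ , τ∈′) = ∈-concatMap⁻ (λ j → map (λ k → (i , j , k)) box) box τ∈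
                        (_ , _ , τ≡) = ∈-map⁻ (λ k → (i , j , k)) τ∈′ in cong proj₁ τ≡))
    where
    box = range0 (2 * n + 1)
    box-unique : Unique box
    box-unique = Unique.upTo⁺ (suc (2 * n + 1))

  degreeProfile∈triples : ∀ n {t} → t ∈ IPT0123 n → degreeProfile t ∈ triples n
  degreeProfile∈triples n {t} t∈ = let ipt = ∈-IPT0123⁻ n t∈ in
    ∈-triples n _ _ _ (trans (weigh-degreeProfile t (Is0123IPT.at3 ipt)) (cong (λ s → 2 * s + 1) (Is0123IPT.len ipt)))

  _==³_ : Triple → Triple → Bool
  (a , b , c) ==³ (i , j , k) = (a ℕ.≡ᵇ i) ∧ (b ℕ.≡ᵇ j) ∧ (c ℕ.≡ᵇ k)

  ==³⇒≡ : ∀ {s t} → T (s ==³ t) → s ≡ t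
  ==³⇒≡ {a , b , c} {i , j , k} eq =
    cong₂ _,_ (≡ᵇ⇒≡ (T-∧⁻ˡ eq)) (cong₂ _,_ (≡ᵇ⇒≡ (T-∧⁻ˡ (T-∧⁻ʳ {a ℕ.≡ᵇ i} eq))) (≡ᵇ⇒≡ (T-∧⁻ʳ {b ℕ.≡ᵇ j} (T-∧⁻ʳ {a ℕ.≡ᵇ i} eq))))

  ==³-refl : ∀ t → T (t ==³ t)
  ==³-refl (a , b , c) = T-∧⁺ (≡⇒≡ᵇ {a} refl) (T-∧⁺ (≡⇒≡ᵇ {b} refl) (≡⇒≡ᵇ {c} refl))

module GammaExpansion {c ℓ : Level} (R : CommutativeSemiring c ℓ) (x y z : CommutativeSemiring.Carrier R) where

  open import Data.Nat as ℕ using (suc)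
  open import Data.List using ([]; _∷_; length)
  open CommutativeSemiring R
  open import Algebra.Solver.Ring.NaturalCoefficients.Default R
  open Poly R using (e₁; e₂; e₃; γExpansion)
  open TripleMonomials using (module Monomial)
  open Monomial R (e₁ x y z) (e₂ x y z) (e₃ x y z)
  open DegreeProfiles
  open Sums R
  open TreeWeights R x y z

  degreeWeight≈monomial : ∀ d → degreeWeight d ≈ monomial (degreeIndicators d)
  degreeWeight≈monomial 0 = solve 1 (λ e → e := con 1 :* con 1 :* (e :* con 1)) refl (e₃ x y z)
  degreeWeight≈monomial 1 = solve 1 (λ e → e := con 1 :* (e :* con 1) :* con 1) refl (e₂ x y z)
  degreeWeight≈monomial 2 = solve 1 (λ e → e := e :* con 1 :* con 1 :* con 1) refl (e₁ x y z)
  degreeWeight≈monomial (suc (suc (suc _))) = sym monomial-0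

  mutual
    treeWeight≈monomial : ∀ t → treeWeight t ≈ monomial (degreeProfile t)
    treeWeight≈monomial (node l cs) =
      trans (*-cong (degreeWeight≈monomial (length cs)) (forestWeight≈monomial cs))
        (sym (monomial-+³ (degreeIndicators (length cs)) (forestProfile cs)))

    forestWeight≈monomial : ∀ ts → forestWeight ts ≈ monomial (forestProfile ts)
    forestWeight≈monomial [] = sym monomial-0
    forestWeight≈monomial (t ∷ ts) =
      trans (*-cong (treeWeight≈monomial t) (forestWeight≈monomial ts))
        (sym (monomial-+³ (degreeProfile t) (forestProfile ts)))

  γExpansion≈∑treeWeight : ∀ n → γExpansion n x y z ≈ ∑ (IPT0123 n) treeWeight
  γExpansion≈∑treeWeight n =
    trans (∑-fibres _==³_ ==³⇒≡ ==³-refl monomial degreeProfile (triples n) (IPT0123 n) (triples-unique n) (degreeProfile∈triples n))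
      (sym (∑-cong (IPT0123 n) (λ {t} _ → treeWeight≈monomial t)))

module GammaRecurrence {c ℓ : Level} (R : CommutativeSemiring c ℓ) (x y z : CommutativeSemiring.Carrier R) where

  open import Data.Nat as ℕ using (suc; _≤_)
  open import Data.Product using (proj₂)
  open import Data.List using (map; concatMap)
  import Relation.Binary.PropositionalEquality as P
  open CommutativeSemiring R
  open import Relation.Binary.Reasoning.Setoid setoid
  open Poly R using (e₃; γExpansion)
  open Sums R
  open DualNumbers R using (Dual; _+ε; ε-part-sum)
  open TreeWeights R x y z using (treeWeight)
  open TreeGrowth using (addLeaf)
  open IncreasingTrees using (IPT0123-suc↭)
  open TreeRecurrence R x y z using (module Wε; ∑-addLeaf)
  open GammaExpansion R x y z using (γExpansion≈∑treeWeight)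
  module Gε = GammaExpansion Dual (x +ε) (y +ε) (z +ε)

  γExpansion-suc : ∀ n → 1 ≤ n → γExpansion (suc n) x y z ≈ e₃ x y z * proj₂ (Poly.γExpansion Dual n (x +ε) (y +ε) (z +ε))
  γExpansion-suc n 1≤n = begin
    γExpansion (suc n) x y z
      ≈⟨ γExpansion≈∑treeWeight (suc n) ⟩
    ∑ (IPT0123 (suc n)) treeWeight
      ≈⟨ ∑-↭ treeWeight (IPT0123-suc↭ n 1≤n) ⟩
    ∑ (concatMap (addLeaf (suc n)) (IPT0123 n)) treeWeight
      ≈⟨ ∑-concatMap (IPT0123 n) (addLeaf (suc n)) treeWeight ⟩
    ∑ (IPT0123 n) (λ t → ∑ (addLeaf (suc n) t) treeWeight)
      ≈⟨ ∑-cong (IPT0123 n) (λ {t} _ → ∑-addLeaf (suc n) t) ⟩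
    ∑ (IPT0123 n) (λ t → e₃ x y z * proj₂ (Wε.treeWeight t))
      ≈⟨ sym (*-distribˡ-∑ (IPT0123 n) (e₃ x y z) (λ t → proj₂ (Wε.treeWeight t))) ⟩
    e₃ x y z * ∑ (IPT0123 n) (λ t → proj₂ (Wε.treeWeight t))
      ≈⟨ *-congˡ (reflexive (P.sym (ε-part-sum (IPT0123 n) Wε.treeWeight))) ⟩
    e₃ x y z * proj₂ (Poly.sumR Dual (map Wε.treeWeight (IPT0123 n)))
      ≈⟨ *-congˡ (proj₂ (CommutativeSemiring.sym Dual (Gε.γExpansion≈∑treeWeight n))) ⟩
    e₃ x y z * proj₂ (Poly.γExpansion Dual n (x +ε) (y +ε) (z +ε)) ∎

theorem4p1 : {c ℓ : Level} (R : CommutativeSemiring c ℓ) (n : ℕ) → 1 ≤ n →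
    (x y z : CommutativeSemiring.Carrier R) →
    CommutativeSemiring._≈_ R (Poly.C R n x y z) (Poly.γExpansion R n x y z)
-- Q 1 = [ 1 1 ] and the only tree on [1] is a leaf, so both sides evaluate to xyz.
theorem4p1 R 1 _ x y z =
  trans (solve 3 (λ x y z → x :* con 1 :* (y :* con 1) :* (z :* con 1) :+ con 0 := x :* y :* z :* con 1 :+ con 0) refl x y z)
    (sym (GammaExpansion.γExpansion≈∑treeWeight R x y z 1))
  where
  open CommutativeSemiring R
  open import Algebra.Solver.Ring.NaturalCoefficients.Default R
theorem4p1 R (suc (suc n)) _ x y z = begin
  Poly.C R (suc (suc n)) x y z
    ≈⟨ StirlingRecurrence.C-suc R x y z (suc n) (s≤s z≤n) ⟩
  x * y * z * proj₂ (Poly.C Dual (suc n) (x +ε) (y +ε) (z +ε))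
    ≈⟨ *-congˡ (proj₂ (theorem4p1 Dual (suc n) (s≤s z≤n) (x +ε) (y +ε) (z +ε))) ⟩
  x * y * z * proj₂ (Poly.γExpansion Dual (suc n) (x +ε) (y +ε) (z +ε))
    ≈⟨ sym (GammaRecurrence.γExpansion-suc R x y z (suc n) (s≤s z≤n)) ⟩
  Poly.γExpansion R (suc (suc n)) x y z ∎
  where
  open CommutativeSemiring R
  open DualNumbers R using (Dual; _+ε)
  open import Relation.Binary.Reasoning.Setoid setoid
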